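{- Let $r\ge2$, $q=2r+1$, let $S_0\subset\mathbb{Z}^r$ be the sublattice generated by $(1,r,0,\dots,0)$ and $k e_1-e_k$ for $k=2,\dots,r$, let $m_1,\dots,m_r\ge3$ be integers, and let $\rho:\mathbb{Z}^r\to\mathbb{Z}_{m_1}\times\dots\times\mathbb{Z}_{m_r}$ be coordinatewise reduction. The graph $C_{m_1}\times\dots\times C_{m_r}$ has a partition of its vertex set into $q$ 1-perfect codes $S^0=\rho(S_0),S^1,\dots,S^{2r}$, each a translate of $\rho(S_0)$, if and only if $m_i$ is a multiple of $q/\gcd(q,i)$ for every $i=1,\dots,r$. In that case: each $S^i$ has cardinality $m_1\cdots m_r/q$; no $S^i$ is the image under the side-identification map $\pi$ of a 1-perfect code of the parallelepiped grid graph $\Gamma$; and the quotient graph of the partition (vertices the $q$ codes, two distinct codes adjacent iff some vertex of one is adjacent to some vertex of the other) is the complete graph $K_q$, namely the undirected Cayley graph of $\mathbb{Z}_q$ with generator set $\{1,2,\dots,r\}$.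
   Context: $C_{m_1}\times\dots\times C_{m_r}$ is the graph with vertex set $\mathbb{Z}_{m_1}\times\dots\times\mathbb{Z}_{m_r}$ in which two vertices are adjacent iff they agree in all coordinates but one, where they differ by $\pm1$. A 1-perfect code is a vertex set $S$ with no two vertices adjacent such that every vertex not in $S$ is adjacent to exactly one vertex of $S$. $e_k$ is the $k$-th standard basis vector of $\mathbb{Z}^r$. $\Gamma$ is the grid graph with vertex set $\{0,\dots,m_1\}\times\dots\times\{0,\dots,m_r\}$ and edges between points at Euclidean distance $1$; $\pi$ reduces the $k$-th coordinate mod $m_k$, identifying opposite faces of $\Gamma$. -}

module Defs where

open import Level using (Level; 0ℓ) renaming (suc to lsuc)
open import Data.Nat as ℕ using (ℕ; zero; suc; _≤_; _<_; ≢-nonZero)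
open import Data.Nat.DivMod using (_/_)
open import Data.Nat.GCD using (gcd; gcd[m,n]≢0)
open import Data.Integer as ℤ using (ℤ; +_; -_; _-_)
open import Data.Integer.Divisibility as ℤD using ()
open import Data.Fin using (Fin; toℕ) renaming (zero to fzero; suc to fsuc)
open import Data.Vec using (Vec; lookup)
open import Data.List using (List; length)
open import Data.List.Membership.Propositional using (_∈_)
open import Data.List.Relation.Unary.Unique.Propositional using (Unique)
open import Data.Product using (Σ; ∃; ∃-syntax; _×_; _,_)
open import Data.Sum using (_⊎_; inj₁)
open import Relation.Binary.PropositionalEquality using (_≡_; _≢_)
open import Relation.Nullary using (¬_)
open import Function.Bundles using (_⇔_)

-- Conventions.  r is the dimension; the coordinate index i ∈ {1,…,r}
-- of the paper is represented by (i : Fin r), i.e. paper index = toℕ i + 1.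
-- Points of ℤ^r are functions Fin r → ℤ.
-- A vertex of C_{m_1}×…×C_{m_r} (vertex set ℤ_{m_1}×…×ℤ_{m_r}) is
-- represented by its canonical representative v : Vec ℕ r with
-- 0 ≤ v_i < m_i.

qOf : ℕ → ℕ
qOf r = suc (2 ℕ.* r)

Σℤ : ∀ {n} → (Fin n → ℤ) → ℤ
Σℤ {zero}  f = + 0
Σℤ {suc n} f = f fzero ℤ.+ Σℤ (λ i → f (fsuc i))

prodℕ : ∀ {n} → Vec ℕ n → ℕ
prodℕ Vec.[] = 1
prodℕ (x Vec.∷ xs) = x ℕ.* prodℕ xs

Cong : ℕ → ℤ → ℤ → Set
Cong n a b = (+ n) ℤD.∣ (a - b)

-- entry j of the k-th generator.
-- generator index fzero   : (1, r, 0, …, 0)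
-- generator index (fsuc k'): paper index k = toℕ (fsuc k') + 1 ∈ {2,…,r},
--                            the vector k e_1 − e_k.
gen : (r : ℕ) → Fin r → Fin r → ℤ
gen r fzero fzero = + 1
gen r fzero (fsuc fzero) = + r
gen r fzero (fsuc (fsuc _)) = + 0
gen r (fsuc k) fzero = + (toℕ (fsuc k) ℕ.+ 1)
gen r (fsuc k) (fsuc j) with toℕ k ℕ.≟ toℕ j
... | Relation.Nullary.yes _ = - (+ 1)
... | Relation.Nullary.no _ = + 0

S₀ : (r : ℕ) → (Fin r → ℤ) → Set
S₀ r x = Σ (Fin r → ℤ) λ c → (∀ j → x j ≡ Σℤ (λ k → c k ℤ.* gen r k j))

module _ {r : ℕ} (m : Vec ℕ r) where

  coord : Vec ℕ r → Fin r → ℤ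
  coord v i = + lookup v i

  InTorus : Vec ℕ r → Set
  InTorus v = ∀ i → lookup v i < lookup m i

  TorusAdj : Vec ℕ r → Vec ℕ r → Set
  TorusAdj u v = InTorus u × InTorus v ×
    ∃[ k ] ((∀ j → j ≢ k → lookup u j ≡ lookup v j) ×
            ((Cong (lookup m k) (coord v k) (coord u k ℤ.+ + 1)) ⊎
             (Cong (lookup m k) (coord v k) (coord u k - + 1))))

  Reduces : (Fin r → ℤ) → Vec ℕ r → Set
  Reduces x w = InTorus w × (∀ i → Cong (lookup m i) (coord w i) (x i))

  ρImage : ((Fin r → ℤ) → Set) → Vec ℕ r → Set
  ρImage P w = ∃[ x ] (P x × Reduces x w)

  Translate : Vec ℕ r → (Vec ℕ r → Set) → Vec ℕ r → Set
  Translate t A w = InTorus w × ∃[ a ] (A a ×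
    (∀ i → Cong (lookup m i) (coord w i) (coord t i ℤ.+ coord a i)))

  IsTranslateOf : (Vec ℕ r → Set) → (Vec ℕ r → Set) → Set
  IsTranslateOf S A = ∃[ t ] (InTorus t × (∀ w → S w ⇔ Translate t A w))

IsPerfectCode : ∀ {n} (V : Vec ℕ n → Set) (E : Vec ℕ n → Vec ℕ n → Set)
  → (Vec ℕ n → Set) → Set
IsPerfectCode V E S =
  (∀ v → S v → V v) ×
  (∀ u v → S u → S v → ¬ E u v) ×
  (∀ v → V v → ¬ S v →
     ∃[ u ] ((S u × E v u) × (∀ u' → S u' → E v u' → u' ≡ u)))

HasCard : ∀ {n} → (Vec ℕ n → Set) → ℕ → Set
HasCard S N = ∃[ L ] (Unique L × (∀ v → (v ∈ L) ⇔ S v) × length L ≡ N)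

module _ {r : ℕ} (m : Vec ℕ r) where

  InGrid : Vec ℕ r → Set
  InGrid v = ∀ i → lookup v i ≤ lookup m i

  -- squared Euclidean distance (Euclidean distance 1 ⇔ squared distance 1)
  sqDist : Vec ℕ r → Vec ℕ r → ℤ
  sqDist u v = Σℤ (λ i → (coord m u i - coord m v i) ℤ.* (coord m u i - coord m v i))

  GridAdj : Vec ℕ r → Vec ℕ r → Set
  GridAdj u v = InGrid u × InGrid v × sqDist u v ≡ + 1

  πImage : (Vec ℕ r → Set) → Vec ℕ r → Set
  πImage T w = ∃[ v ] (T v × Reduces m (coord m v) w)

module _ (r : ℕ) (m : Vec ℕ r) where

  IsCodePartition : (Fin (qOf r) → Vec ℕ r → Set) → Set
  IsCodePartition S =
    (∀ w → S fzero w ⇔ ρImage m (S₀ r) w) ×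
    (∀ j → IsTranslateOf m (S j) (ρImage m (S₀ r))) ×
    (∀ j → IsPerfectCode (InTorus m) (TorusAdj m) (S j)) ×
    (∀ j → ∀ w → S j w → InTorus m w) ×
    (∀ w → InTorus m w → ∃[ j ] S j w) ×
    (∀ j j' w → j ≢ j' → S j w → S j' w → ⊥')
    where open import Data.Empty renaming (⊥ to ⊥')

  QuotAdj : (Fin (qOf r) → Vec ℕ r → Set) → Fin (qOf r) → Fin (qOf r) → Set
  QuotAdj S j j' = j ≢ j' × ∃[ u ] ∃[ v ] (S j u × S j' v × TorusAdj m u v)

CayleyAdj : (r : ℕ) → Fin (qOf r) → Fin (qOf r) → Set
CayleyAdj r a b = ∃[ s ] ((1 ≤ s × s ≤ r) ×
  ((Cong (qOf r) (+ toℕ b) (+ toℕ a ℤ.+ + s)) ⊎ (Cong (qOf r) (+ toℕ b) (+ toℕ a - + s))))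

-- q / gcd(q, i), where i ≥ 1 is a paper index
q/gcd : (r i : ℕ) → ℕ
q/gcd r i = _/_ (qOf r) (gcd (qOf r) i)
  {{≢-nonZero (gcd[m,n]≢0 (qOf r) i (inj₁ (λ ())))}}

module Submission where

-- Give coordinate i (paper index i+1) the weight i+1 and let
-- Φ x = Σ (i+1)·x_i.  The 2r signed weights ±1,…,±r are exactly the nonzero
-- residues modulo q = 2r+1, each once, and S₀ is the kernel of Φ mod q.
-- Φ descends to the torus exactly when q ∣ i·m_i for all i, which is the
-- condition q/gcd(q,i) ∣ m_i.  Under it every fibre of Φ mod q is a
-- 1-perfect code (an outside vertex meets the fibre by the unique step whose
-- signed weight is the missing residue), ρ(S₀) is the fibre over 0, and a
-- translate t + ρ(S₀) is the fibre over Φ t; so the q fibres form the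
-- partition and every partition consists of fibres with distinct residues.
-- Conversely, if q ∤ i·m_i, then i·m_i ≡ ±(k+1) and ρ(S₀) contains two
-- adjacent vertices.  The remaining claims follow: fibres are counted along
-- the first axis (m₁/q choices per tail), two distinct fibres are always
-- adjacent (whence the complete Cayley graph), and a grid code would force
-- a neighbour outside Γ.

module Development where

  open import Defs
  open import Level using (0ℓ)
  open import Data.Nat as ℕ using (ℕ; zero; suc; z≤n; s≤s; NonZero)
  import Data.Nat.Properties as ℕP
  import Data.Nat.Divisibility as ℕD
  open import Data.Nat.DivMod using (_/_; _%_; m/n*n≡m; m*n/n≡m; m≡m%n+[m/n]*n; m%n<n; m<n*o⇒m/o<n)
  open import Data.List using (List; []; _∷_; map; concatMap; length; upTo)
  import Data.List.Properties as LP
  open import Data.List.Membership.Propositional using (_∈_; find; lose)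
  open import Data.List.Membership.Propositional.Properties using (∈-concatMap⁺; ∈-concatMap⁻; ∈-map⁺; ∈-map⁻; ∈-upTo⁺; ∈-upTo⁻)
  open import Data.List.Relation.Unary.Any using (here)
  open import Data.List.Relation.Unary.Unique.Propositional using (Unique)
  open import Data.List.Relation.Unary.AllPairs using ([]; _∷_)
  import Data.List.Relation.Unary.All as All
  import Data.List.Relation.Unary.Unique.Propositional.Properties as UniqueP
  open import Data.Nat.GCD using (gcd; gcd[m,n]≢0; gcd[m,n]∣m; gcd[m,n]∣n)
  open import Data.Nat.Coprimality using (coprime-/gcd; coprime-divisor)
  import Data.Nat.Tactic.RingSolver as ℕSolver
  open import Data.Vec using (Vec; []; _∷_; lookup; tabulate; replicate; _[_]≔_)
  open import Data.Vec.Properties using (∷-injective; lookup∘updateAt; lookup∘updateAt′; lookup∘tabulate; tabulate∘lookup; tabulate-cong; lookup-replicate)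
  open import Data.Integer as ℤ using (ℤ; +_; -[1+_]; _+_; _*_; -_; _-_; +0)
  import Data.Integer.Properties as ℤP
  open import Data.Integer.Divisibility.Signed using (_∣_; _∣?_; divides; ∣-refl; ∣m∣n⇒∣m+n; ∣m⇒∣-m; ∣n⇒∣m*n; ∣⇒∣ᵤ; ∣ᵤ⇒∣)
  open import Data.Integer.DivMod using (_%ℕ_; _/ℕ_; a≡a%ℕn+[a/ℕn]*n; n%ℕd<d)
  open import Data.Fin as F using (Fin; toℕ; fromℕ<) renaming (zero to fzero; suc to fsuc)
  import Data.Fin.Properties as FP
  open import Data.Product using (∃-syntax; _×_; _,_; proj₁; proj₂)
  open import Data.Sum using (_⊎_; inj₁; inj₂)
  open import Data.Empty using (⊥; ⊥-elim)
  open import Function.Base using (_$_)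
  open import Relation.Binary.PropositionalEquality
  open import Relation.Binary.Bundles using (Setoid)
  open import Function.Bundles using (_⇔_; mk⇔; Equivalence)
  open import Function.Properties.Equivalence using () renaming (trans to ⇔-trans; sym to ⇔-sym)
  open import Relation.Nullary using (¬_; Dec; yes; no)
  open import Data.Integer.Tactic.RingSolver using (solve-∀)

  Σ-cong : ∀ {n} {f g : Fin n → ℤ} → (∀ i → f i ≡ g i) → Σℤ f ≡ Σℤ g
  Σ-cong {zero}  h = refl
  Σ-cong {suc n} h = cong₂ _+_ (h fzero) (Σ-cong (λ i → h (fsuc i)))

  Σ-+ : ∀ {n} (f g : Fin n → ℤ) → Σℤ (λ i → f i + g i) ≡ Σℤ f + Σℤ g
  Σ-+ {zero}  f g = refl
  Σ-+ {suc n} f g rewrite Σ-+ (λ i → f (fsuc i)) (λ i → g (fsuc i)) =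
    interchange (f fzero) (g fzero) _ _
    where
    interchange : ∀ a b c d → a + b + (c + d) ≡ a + c + (b + d)
    interchange = solve-∀

  Σ-* : ∀ {n} (c : ℤ) (f : Fin n → ℤ) → Σℤ (λ i → c * f i) ≡ c * Σℤ f
  Σ-* {zero}  c f = sym (ℤP.*-zeroʳ c)
  Σ-* {suc n} c f rewrite Σ-* c (λ i → f (fsuc i)) = sym (ℤP.*-distribˡ-+ c (f fzero) _)

  Σ-neg : ∀ {n} (f : Fin n → ℤ) → Σℤ (λ i → - f i) ≡ - Σℤ f
  Σ-neg {zero}  f = refl
  Σ-neg {suc n} f rewrite Σ-neg (λ i → f (fsuc i)) = sym (ℤP.neg-distrib-+ (f fzero) _)

  Σ-- : ∀ {n} (f g : Fin n → ℤ) → Σℤ (λ i → f i - g i) ≡ Σℤ f - Σℤ g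
  Σ-- f g = trans (Σ-+ f (λ i → - g i)) (cong (_+_ (Σℤ f)) (Σ-neg g))

  Σ-zero : ∀ {n} (f : Fin n → ℤ) → (∀ i → f i ≡ + 0) → Σℤ f ≡ + 0
  Σ-zero {zero}  f h = refl
  Σ-zero {suc n} f h rewrite h fzero | Σ-zero (λ i → f (fsuc i)) (λ i → h (fsuc i)) = refl

  Σ-single : ∀ {n} (f : Fin n → ℤ) (k : Fin n) → (∀ j → j ≢ k → f j ≡ + 0) → Σℤ f ≡ f k
  Σ-single {suc n} f fzero h
    rewrite Σ-zero (λ i → f (fsuc i)) (λ i → h (fsuc i) (λ ())) = ℤP.+-identityʳ _
  Σ-single {suc n} f (fsuc k) h rewrite h fzero (λ ()) =
    trans (ℤP.+-identityˡ _)
          (Σ-single (λ i → f (fsuc i)) k (λ j j≢k → h (fsuc j) (λ e → j≢k (FP.suc-injective e))))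

  Σ-swap : ∀ {n p} (f : Fin n → Fin p → ℤ) →
    Σℤ (λ i → Σℤ (λ j → f i j)) ≡ Σℤ (λ j → Σℤ (λ i → f i j))
  Σ-swap {zero}  {p} f = sym (Σ-zero {p} (λ j → + 0) (λ _ → refl))
  Σ-swap {suc n} {p} f rewrite Σ-swap (λ i j → f (fsuc i) j) =
    sym (Σ-+ (λ j → f fzero j) (λ j → Σℤ (λ i → f (fsuc i) j)))

  Σ-∣ : ∀ {n} {d : ℤ} (f : Fin n → ℤ) → (∀ i → d ∣ f i) → d ∣ Σℤ f
  Σ-∣ {zero}  f h = divides +0 refl
  Σ-∣ {suc n} f h = ∣m∣n⇒∣m+n (h fzero) (Σ-∣ (λ i → f (fsuc i)) (λ i → h (fsuc i)))

  -- It is a record, so that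
  -- both sides can be recovered by unification, and it forms a setoid, so
  -- that chains of congruences can be written with equational reasoning.

  infix 4 _≡_⟨mod_⟩
  record _≡_⟨mod_⟩ (a b : ℤ) (n : ℕ) : Set where
    constructor congruent
    field ∣-diff : + n ∣ (a - b)
  open _≡_⟨mod_⟩ public

  module _ {n : ℕ} where

    mod-reflexive : ∀ {a b} → a ≡ b → a ≡ b ⟨mod n ⟩
    mod-reflexive {a} refl = congruent (divides +0 (ℤP.+-inverseʳ a))

    mod-refl : ∀ {a} → a ≡ a ⟨mod n ⟩
    mod-refl = mod-reflexive refl

    mod-sym : ∀ {a b} → a ≡ b ⟨mod n ⟩ → b ≡ a ⟨mod n ⟩
    mod-sym {a} {b} (congruent d) = congruent (subst (+ n ∣_) (negate a b) (∣m⇒∣-m d))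
      where
      negate : ∀ a b → - (a - b) ≡ b - a
      negate = solve-∀

    mod-trans : ∀ {a b c} → a ≡ b ⟨mod n ⟩ → b ≡ c ⟨mod n ⟩ → a ≡ c ⟨mod n ⟩
    mod-trans {a} {b} {c} (congruent d) (congruent e) =
      congruent (subst (+ n ∣_) (telescope a b c) (∣m∣n⇒∣m+n d e))
      where
      telescope : ∀ a b c → (a - b) + (b - c) ≡ a - c
      telescope = solve-∀

    mod-+ : ∀ {a b c d} → a ≡ b ⟨mod n ⟩ → c ≡ d ⟨mod n ⟩ → a + c ≡ b + d ⟨mod n ⟩
    mod-+ {a} {b} {c} {d} (congruent e) (congruent f) =
      congruent (subst (+ n ∣_) (regroup a b c d) (∣m∣n⇒∣m+n e f))
      where
      regroup : ∀ a b c d → (a - b) + (c - d) ≡ (a + c) - (b + d)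
      regroup = solve-∀

    mod-neg : ∀ {a b} → a ≡ b ⟨mod n ⟩ → - a ≡ - b ⟨mod n ⟩
    mod-neg {a} {b} (congruent d) = congruent (subst (+ n ∣_) (negate a b) (∣m⇒∣-m d))
      where
      negate : ∀ a b → - (a - b) ≡ - a - - b
      negate = solve-∀

    mod-- : ∀ {a b c d} → a ≡ b ⟨mod n ⟩ → c ≡ d ⟨mod n ⟩ → a - c ≡ b - d ⟨mod n ⟩
    mod-- e f = mod-+ e (mod-neg f)

    diff⇔sum : ∀ {a b s} → (b - a ≡ s ⟨mod n ⟩) ⇔ (b ≡ a + s ⟨mod n ⟩)
    diff⇔sum {a} {b} {s} = mk⇔
      (λ e → subst (_≡ a + s ⟨mod n ⟩) (restore a b) (mod-+ (mod-refl {a = a}) e))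
      (λ e → subst (b - a ≡_⟨mod n ⟩) (cancel a s) (mod-- e (mod-refl {a = a})))
      where
      restore : ∀ a b → a + (b - a) ≡ b
      restore = solve-∀
      cancel : ∀ a s → a + s - a ≡ s
      cancel = solve-∀

    offset : ∀ {a a' s c} → a' ≡ a + s ⟨mod n ⟩ → a' ≡ c ⟨mod n ⟩ → s ≡ c - a ⟨mod n ⟩
    offset e f = mod-sym (Equivalence.from diff⇔sum (mod-trans (mod-sym f) e))

    ∣⇒≡0 : ∀ {x} → + n ∣ x → x ≡ + 0 ⟨mod n ⟩
    ∣⇒≡0 {x} d = congruent (subst (+ n ∣_) (sym (ℤP.+-identityʳ x)) d)

    ≡0⇒∣ : ∀ {x} → x ≡ + 0 ⟨mod n ⟩ → + n ∣ x
    ≡0⇒∣ {x} (congruent d) = subst (+ n ∣_) (ℤP.+-identityʳ x) d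

    %ℕ-≡ : ∀ (x : ℤ) .{{_ : NonZero n}} → x ≡ + (x %ℕ n) ⟨mod n ⟩
    %ℕ-≡ x = congruent (divides (x /ℕ n)
      (trans (cong (_- + (x %ℕ n)) (a≡a%ℕn+[a/ℕn]*n x n)) (cancel (+ (x %ℕ n)) ((x /ℕ n) * + n))))
      where
      cancel : ∀ a b → a + b - a ≡ b
      cancel = solve-∀

    Cong⇒≡ : ∀ {a b} → Cong n a b → a ≡ b ⟨mod n ⟩
    Cong⇒≡ {a} {b} c = congruent (∣ᵤ⇒∣ {+ n} {a - b} c)

    ≡⇒Cong : ∀ {a b} → a ≡ b ⟨mod n ⟩ → Cong n a b
    ≡⇒Cong {a} {b} (congruent d) = ∣⇒∣ᵤ {+ n} {a - b} d

  Σ-mod : ∀ {n p} {f g : Fin n → ℤ} → (∀ i → f i ≡ g i ⟨mod p ⟩) → Σℤ f ≡ Σℤ g ⟨mod p ⟩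
  Σ-mod {zero}  h = mod-refl
  Σ-mod {suc n} h = mod-+ (h fzero) (Σ-mod (λ i → h (fsuc i)))

  modSetoid : ℕ → Setoid 0ℓ 0ℓ
  modSetoid n = record
    { Carrier = ℤ
    ; _≈_ = _≡_⟨mod n ⟩
    ; isEquivalence = record
      { refl = mod-refl ; sym = mod-sym ; trans = mod-trans }
    }

  ≡-below-modulus : ∀ {n a b} → a ℕ.< n → b ℕ.< n → + a ≡ + b ⟨mod n ⟩ → a ≡ b
  ≡-below-modulus {n} {a} {b} a<n b<n d =
    ℤP.+-injective (ℤP.i-j≡0⇒i≡j _ _ (small-multiple-is-zero _ bound (∣-diff d)))
    where
    small-multiple-is-zero : ∀ x → ℤ.∣ x ∣ ℕ.< n → + n ∣ x → x ≡ + 0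
    small-multiple-is-zero x lt n∣x with ℤ.∣ x ∣ ℕ.≟ 0
    ... | yes e = ℤP.∣i∣≡0⇒i≡0 e
    ... | no ne = ⊥-elim (ℕP.<⇒≱ lt (ℕD.∣⇒≤ {{ℕ.≢-nonZero ne}} (∣⇒∣ᵤ n∣x)))
    bound : ℤ.∣ + a - + b ∣ ℕ.< n
    bound rewrite ℤP.m-n≡m⊖n a b with ℕP.≤-total a b
    ... | inj₁ a≤b rewrite ℤP.∣⊖∣-≤ a≤b = ℕP.≤-<-trans (ℕP.m∸n≤m b a) b<n
    ... | inj₂ b≤a rewrite ℤP.∣m⊖n∣≡∣n⊖m∣ a b | ℤP.∣⊖∣-≤ b≤a = ℕP.≤-<-trans (ℕP.m∸n≤m a b) a<n

  -- Residues modulo q = 2r+1.  The coordinate i (paper index i+1) carries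
  -- the weight wt i = i+1; the 2r signed weights ±1,…,±r are exactly the
  -- nonzero residues modulo q, each occurring once.

  wt : ∀ {r} → Fin r → ℤ
  wt i = + (toℕ i ℕ.+ 1)

  wt-bound : ∀ {r} (i : Fin r) → toℕ i ℕ.+ 1 ℕ.≤ r
  wt-bound {r} i = subst (ℕ._≤ r) (ℕP.+-comm 1 (toℕ i)) (FP.toℕ<n i)

  data Sign : Set where
    up down : Sign

  signed : Sign → ℤ → ℤ
  signed up   x = x
  signed down x = - x

  flip : Sign → Sign
  flip up   = down
  flip down = up

  unit : Sign → ℤ
  unit σ = signed σ (+ 1)

  signed-as-* : ∀ σ x → signed σ x ≡ x * unit σ
  signed-as-* up   x = sym (ℤP.*-identityʳ x)
  signed-as-* down x = sym (trans (ℤP.*-comm x (- + 1)) (ℤP.-1*i≡-i x))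

  signed-flip : ∀ σ x → signed (flip σ) x ≡ - signed σ x
  signed-flip up   x = refl
  signed-flip down x = sym (ℤP.neg-involutive x)

  small≢0 : ∀ r s → 1 ℕ.≤ s → s ℕ.≤ 2 ℕ.* r → ¬ (+ s ≡ + 0 ⟨mod qOf r ⟩)
  small≢0 r (suc s) _ s≤2r d with ≡-below-modulus (s≤s s≤2r) (s≤s z≤n) d
  ... | ()

  weight-sum-bound : ∀ {r} (k k' : Fin r) → toℕ k ℕ.+ 1 ℕ.+ (toℕ k' ℕ.+ 1) ℕ.≤ 2 ℕ.* r
  weight-sum-bound {r} k k' =
    ℕP.≤-trans (ℕP.+-mono-≤ (wt-bound k) (wt-bound k'))
               (ℕP.≤-reflexive (cong (r ℕ.+_) (sym (ℕP.+-identityʳ r))))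

  signed-weight≢0 : ∀ {r} σ (k : Fin r) → ¬ (signed σ (wt k) ≡ + 0 ⟨mod qOf r ⟩)
  signed-weight≢0 {r} up   k d = small≢0 r _ (ℕP.m≤n+m 1 (toℕ k)) (ℕP.≤-trans (wt-bound k) (ℕP.m≤n*m r 2)) d
  signed-weight≢0 {r} down k d =
    signed-weight≢0 up k (subst (_≡ + 0 ⟨mod qOf r ⟩) (ℤP.neg-involutive (wt k)) (mod-neg d))

  signed-weights-distinct : ∀ {r} σ σ' (k k' : Fin r) →
    signed σ (wt k) ≡ signed σ' (wt k') ⟨mod qOf r ⟩ → σ ≡ σ' × k ≡ k'
  signed-weights-distinct {r} σ σ' k k' d = go σ σ' d
    where
    wt<q : ∀ (i : Fin r) → toℕ i ℕ.+ 1 ℕ.< qOf r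
    wt<q i = ℕP.≤-<-trans (wt-bound i) (s≤s (ℕP.m≤n*m r 2))
    same : + (toℕ k ℕ.+ 1) ≡ + (toℕ k' ℕ.+ 1) ⟨mod qOf r ⟩ → k ≡ k'
    same e = FP.toℕ-injective (ℕP.+-cancelʳ-≡ _ _ _ (≡-below-modulus (wt<q k) (wt<q k') e))
    opposite : wt k ≡ - wt k' ⟨mod qOf r ⟩ → ⊥
    opposite e = small≢0 r _ (ℕP.≤-trans (ℕP.m≤n+m 1 (toℕ k)) (ℕP.m≤m+n _ _)) (weight-sum-bound k k')
      (subst (_≡ + 0 ⟨mod qOf r ⟩) (sym (ℤP.pos-+ (toℕ k ℕ.+ 1) (toℕ k' ℕ.+ 1)))
        (mod-trans (mod-+ e (mod-refl {a = wt k'})) (mod-reflexive (ℤP.+-inverseˡ (wt k')))))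
    go : ∀ σ σ' → signed σ (wt k) ≡ signed σ' (wt k') ⟨mod qOf r ⟩ → σ ≡ σ' × k ≡ k'
    go up   up   e = refl , same e
    go down down e = refl , same (subst₂ (_≡_⟨mod qOf r ⟩) (ℤP.neg-involutive _) (ℤP.neg-involutive _) (mod-neg e))
    go up   down e = ⊥-elim (opposite e)
    go down up   e = ⊥-elim (opposite (subst (_≡ - wt k' ⟨mod qOf r ⟩) (ℤP.neg-involutive _) (mod-neg e)))

  nonzero-residue-small : ∀ r (D : ℤ) → ¬ (D ≡ + 0 ⟨mod qOf r ⟩) →
    ∃[ s ] ((1 ℕ.≤ s × s ℕ.≤ r) × (D ≡ + s ⟨mod qOf r ⟩ ⊎ D ≡ - + s ⟨mod qOf r ⟩))
  nonzero-residue-small r D D≢0 with D %ℕ qOf r in eq | D %ℕ qOf r ℕ.≤? r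
  ... | zero  | _ = ⊥-elim (D≢0 (subst (λ d → D ≡ + d ⟨mod qOf r ⟩) eq (%ℕ-≡ D)))
  ... | suc d | yes d+1≤r = suc d , (s≤s z≤n , d+1≤r) , inj₁ (subst (λ d → D ≡ + d ⟨mod qOf r ⟩) eq (%ℕ-≡ D))
  ... | suc d | no d+1≰r = qOf r ℕ.∸ suc d , (1≤q-d , q-d≤r) , inj₂ D≡d-q
    where
    d<q : suc d ℕ.< qOf r
    d<q = subst (ℕ._< qOf r) eq (n%ℕd<d D (qOf r))
    1≤q-d : 1 ℕ.≤ qOf r ℕ.∸ suc d
    1≤q-d = ℕP.m<n⇒0<n∸m d<q
    q-d≤r : qOf r ℕ.∸ suc d ℕ.≤ r
    q-d≤r = ℕP.≤-trans (ℕP.∸-monoʳ-≤ (qOf r) (ℕP.≰⇒> d+1≰r)) (ℕP.≤-reflexive 2r∸r≡r)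
      where
      2r∸r≡r : 2 ℕ.* r ℕ.∸ r ≡ r
      2r∸r≡r rewrite ℕP.+-identityʳ r = ℕP.m+n∸m≡n r r
    q-d≡ : + qOf r - + suc d ≡ + (qOf r ℕ.∸ suc d)
    q-d≡ = trans (ℤP.m-n≡m⊖n (qOf r) (suc d)) (ℤP.⊖-≥ (ℕP.<⇒≤ d<q))
    d≡d-q : + suc d ≡ - + (qOf r ℕ.∸ suc d) ⟨mod qOf r ⟩
    d≡d-q = congruent (divides (+ 1)
      (subst (λ x → + suc d - - x ≡ + 1 * + qOf r) q-d≡ (complement (+ suc d) (+ qOf r))))
      where
      complement : ∀ a Q → a - - (Q - a) ≡ + 1 * Q
      complement = solve-∀
    D≡d-q : D ≡ - + (qOf r ℕ.∸ suc d) ⟨mod qOf r ⟩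
    D≡d-q = mod-trans (subst (λ d → D ≡ + d ⟨mod qOf r ⟩) eq (%ℕ-≡ D)) d≡d-q

  nonzero-residue-weight : ∀ r (D : ℤ) → ¬ (D ≡ + 0 ⟨mod qOf r ⟩) →
    ∃[ k ] ∃[ σ ] (D ≡ signed σ (wt {r} k) ⟨mod qOf r ⟩)
  nonzero-residue-weight r D D≢0 with nonzero-residue-small r D D≢0
  ... | suc s , (_ , s<r) , D≡±s = fromℕ< s<r , signOf D≡±s
    where
    wt≡ : wt (fromℕ< s<r) ≡ + suc s
    wt≡ = cong +_ (trans (cong (ℕ._+ 1) (FP.toℕ-fromℕ< s<r)) (ℕP.+-comm s 1))
    signOf : D ≡ + suc s ⟨mod qOf r ⟩ ⊎ D ≡ - + suc s ⟨mod qOf r ⟩ →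
             ∃[ σ ] (D ≡ signed σ (wt (fromℕ< s<r)) ⟨mod qOf r ⟩)
    signOf (inj₁ e) = up   , subst (λ x → D ≡ x ⟨mod qOf r ⟩) (sym wt≡) e
    signOf (inj₂ e) = down , subst (λ x → D ≡ - x ⟨mod qOf r ⟩) (sym wt≡) e

  Φ : ∀ {r} → (Fin r → ℤ) → ℤ
  Φ x = Σℤ (λ i → wt i * x i)

  Φ-+ : ∀ {r} (x y : Fin r → ℤ) → Φ (λ i → x i + y i) ≡ Φ x + Φ y
  Φ-+ x y = trans (Σ-cong (λ i → ℤP.*-distribˡ-+ (wt i) (x i) (y i))) (Σ-+ (λ i → wt i * x i) (λ i → wt i * y i))

  Φ-- : ∀ {r} (x y : Fin r → ℤ) → Φ (λ i → x i - y i) ≡ Φ x - Φ y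
  Φ-- x y = trans (Σ-cong (λ i → distrib (wt i) (x i) (y i))) (Σ-- (λ i → wt i * x i) (λ i → wt i * y i))
    where
    distrib : ∀ w a b → w * (a - b) ≡ w * a - w * b
    distrib = solve-∀

  Φ-zero : ∀ {r} (x : Fin r → ℤ) → (∀ i → x i ≡ + 0) → Φ x ≡ + 0
  Φ-zero x h = Σ-zero _ (λ i → trans (cong (wt i *_) (h i)) (ℤP.*-zeroʳ (wt i)))

  Φ-single : ∀ {r} (x y : Fin r → ℤ) (k : Fin r) → (∀ j → j ≢ k → x j ≡ y j) →
    Φ x - Φ y ≡ wt k * (x k - y k)
  Φ-single x y k agree = trans (sym (Φ-- x y))
    (Σ-single _ k (λ j j≢k → trans (cong (λ z → wt j * (z - y j)) (agree j j≢k))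
                                   (trans (cong (wt j *_) (ℤP.+-inverseʳ (y j))) (ℤP.*-zeroʳ (wt j)))))

  δ : ∀ {r} → Fin r → ℤ → Fin r → ℤ
  δ k c j with j F.≟ k
  ... | yes _ = c
  ... | no _  = + 0

  δ-at : ∀ {r} (k : Fin r) c → δ k c k ≡ c
  δ-at k c with k F.≟ k
  ... | yes _ = refl
  ... | no k≢k = ⊥-elim (k≢k refl)

  δ-off : ∀ {r} (k j : Fin r) c → j ≢ k → δ k c j ≡ + 0
  δ-off k j c j≢k with j F.≟ k
  ... | yes j≡k = ⊥-elim (j≢k j≡k)
  ... | no _    = refl

  Φ-δ : ∀ {r} (k : Fin r) c → Φ (δ k c) ≡ wt k * c
  Φ-δ k c = trans (Σ-single _ k (λ j j≢k → trans (cong (wt j *_) (δ-off k j c j≢k)) (ℤP.*-zeroʳ (wt j))))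
                  (cong (wt k *_) (δ-at k c))

  -- The lattice S₀ (r ≥ 2) is the kernel of Φ modulo q: its generators
  -- (1,r,0,…,0) and k e₁ - e_k have weights q and 0, and conversely a
  -- point of weight K·q is the combination with coefficients
  -- K, rK - x₁, -x₂, …, -x_{r-1} of the generators.

  gen-diag : ∀ {r'} (k : Fin r') → gen (suc r') (fsuc k) (fsuc k) ≡ - + 1
  gen-diag k with toℕ k ℕ.≟ toℕ k
  ... | yes _ = refl
  ... | no k≢k = ⊥-elim (k≢k refl)

  gen-off : ∀ {r'} (k j : Fin r') → k ≢ j → gen (suc r') (fsuc k) (fsuc j) ≡ + 0
  gen-off k j k≢j with toℕ k ℕ.≟ toℕ j
  ... | yes e = ⊥-elim (k≢j (FP.toℕ-injective e))
  ... | no _  = refl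

  module _ (n : ℕ) where

    private
      r : ℕ
      r = suc (suc n)

    Φ-gen : ∀ k → Φ (gen r k) ≡ + 0 ⟨mod qOf r ⟩
    Φ-gen fzero = ∣⇒≡0 (divides (+ 1) (trans weight≡q (sym (ℤP.*-identityˡ _))))
      where
      weight≡q : Φ (gen r fzero) ≡ + qOf r
      weight≡q = trans (cong (λ z → + 1 * + 1 + (+ 2 * + r + z)) (Φ-zero (λ i → gen r fzero (fsuc (fsuc i))) (λ _ → refl)))
                       (cong (λ z → + 1 + z) (trans (ℤP.+-identityʳ (+ 2 * + r)) (sym (ℤP.pos-* 2 r))))
    Φ-gen (fsuc k) = mod-reflexive (trans single (cancel (wt (fsuc k))))
      where
      single : Φ (gen r (fsuc k)) ≡ + 1 * wt (fsuc k) + wt (fsuc k) * - + 1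
      single = cong (λ z → + 1 * wt (fsuc k) + z)
        (trans (Σ-single _ k (λ j j≢k → trans (cong (wt (fsuc j) *_) (gen-off k j (λ e → j≢k (sym e))))
                                              (ℤP.*-zeroʳ (wt (fsuc j)))))
               (cong (wt (fsuc k) *_) (gen-diag k)))
      cancel : ∀ a → + 1 * a + a * - + 1 ≡ + 0
      cancel = solve-∀

    S₀⇒Φ≡0 : ∀ x → S₀ r x → Φ x ≡ + 0 ⟨mod qOf r ⟩
    S₀⇒Φ≡0 x (c , x≡) = ∣⇒≡0 (subst (+ qOf r ∣_) (sym Φx≡)
      (Σ-∣ _ (λ k → subst (+ qOf r ∣_) (sym (coefficient k)) (∣n⇒∣m*n (c k) (≡0⇒∣ (Φ-gen k))))))
      where
      reassoc : ∀ w c g → w * (c * g) ≡ c * (w * g)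
      reassoc = solve-∀
      coefficient : ∀ k → Σℤ (λ j → wt j * (c k * gen r k j)) ≡ c k * Φ (gen r k)
      coefficient k = trans (Σ-cong (λ j → reassoc (wt j) (c k) (gen r k j))) (Σ-* (c k) (λ j → wt j * gen r k j))
      Φx≡ : Φ x ≡ Σℤ (λ k → Σℤ (λ j → wt j * (c k * gen r k j)))
      Φx≡ = trans (Σ-cong (λ j → trans (cong (wt j *_) (x≡ j)) (sym (Σ-* (wt j) (λ k → c k * gen r k j)))))
                  (Σ-swap (λ j k → wt j * (c k * gen r k j)))

    Φ≡0⇒S₀ : ∀ x → Φ x ≡ + 0 ⟨mod qOf r ⟩ → S₀ r x
    Φ≡0⇒S₀ x Φx≡0 with ≡0⇒∣ Φx≡0
    ... | divides K ΦxK = c , component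
      where
      c : Fin r → ℤ
      c fzero            = K
      c (fsuc fzero)     = + r * K - x (fsuc fzero)
      c (fsuc (fsuc l))  = - x (fsuc (fsuc l))
      R : ℤ
      R = Σℤ (λ l → wt (fsuc (fsuc l)) * x (fsuc (fsuc l)))
      first : ∀ x0 x1 R K r → + 1 * x0 + (+ 2 * x1 + R) ≡ K * (+ 1 + + 2 * r) →
              x0 ≡ K * + 1 + ((r * K - x1) * + 2 + - R)
      first x0 x1 R K r h = trans (isolate x0 x1 R) (trans (cong (λ z → z - + 2 * x1 - R) h) (expand x1 R K r))
        where
        isolate : ∀ x0 x1 R → x0 ≡ (+ 1 * x0 + (+ 2 * x1 + R)) - + 2 * x1 - R
        isolate = solve-∀
        expand : ∀ x1 R K r → K * (+ 1 + + 2 * r) - + 2 * x1 - R ≡ K * + 1 + ((r * K - x1) * + 2 + - R)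
        expand = solve-∀
      second : ∀ x1 K r → x1 ≡ K * r + ((r * K - x1) * - + 1 + + 0)
      second = solve-∀
      other : ∀ x K → x ≡ K * + 0 + (+ 0 + - x * - + 1)
      other = solve-∀
      neg-* : ∀ a w → - a * w ≡ - (w * a)
      neg-* = solve-∀
      component : ∀ j → x j ≡ Σℤ (λ k → c k * gen r k j)
      -- first coordinate: K·q - 2·x₁ - R = x₀ since Φ x = K·q
      component fzero = trans
        (first (x fzero) (x (fsuc fzero)) R K (+ r) (trans ΦxK (cong (λ z → K * (+ 1 + z)) (ℤP.pos-* 2 r))))
        (cong (λ z → K * + 1 + ((+ r * K - x (fsuc fzero)) * + 2 + z))
          (sym (trans (Σ-cong (λ l → neg-* (x (fsuc (fsuc l))) (wt (fsuc (fsuc l)))))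
                      (Σ-neg (λ l → wt (fsuc (fsuc l)) * x (fsuc (fsuc l)))))))
      -- second coordinate: only the first two generators contribute
      component (fsuc fzero) = trans (second (x (fsuc fzero)) K (+ r))
        (cong₂ (λ u v → K * + r + ((+ r * K - x (fsuc fzero)) * u + v)) (sym (gen-diag {suc n} fzero))
          (sym (Σ-zero _ (λ l → trans (cong (c (fsuc (fsuc l)) *_) (gen-off (fsuc l) fzero (λ ())))
                                      (ℤP.*-zeroʳ (c (fsuc (fsuc l))))))))
      -- later coordinates: only the generator (l₀+3) e₁ - e_{l₀+3} contributes
      component (fsuc (fsuc l₀)) = trans (other (x (fsuc (fsuc l₀))) K)
        (cong₂ (λ u v → K * + 0 + (u + v))
          (trans (sym (ℤP.*-zeroʳ (c (fsuc fzero)))) (cong (c (fsuc fzero) *_) (sym (gen-off fzero (fsuc l₀) (λ ())))))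
          (sym (trans (Σ-single _ l₀ (λ j j≢l₀ → trans (cong (c (fsuc (fsuc j)) *_)
                                                          (gen-off (fsuc j) (fsuc l₀) (λ e → j≢l₀ (FP.suc-injective e))))
                                                       (ℤP.*-zeroʳ (c (fsuc (fsuc j))))))
                      (cong (c (fsuc (fsuc l₀)) *_) (gen-diag (fsuc l₀))))))

  module _ (r a : ℕ) where

    private
      g : ℕ
      g = gcd (qOf r) a
      instance
        g≢0 : NonZero g
        g≢0 = ℕ.≢-nonZero (gcd[m,n]≢0 (qOf r) a (inj₁ (λ ())))

    q/gcd∣⇒q∣* : ∀ {m} → q/gcd r a ℕD.∣ m → qOf r ℕD.∣ a ℕ.* m
    q/gcd∣⇒q∣* {m} (ℕD.divides t m≡) = ℕD.divides (a / g ℕ.* t) (begin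
        a ℕ.* m                          ≡⟨ cong₂ ℕ._*_ (sym (m/n*n≡m (gcd[m,n]∣n (qOf r) a))) m≡ ⟩
        a / g ℕ.* g ℕ.* (t ℕ.* (qOf r / g)) ≡⟨ regroup (a / g) g t (qOf r / g) ⟩
        (a / g ℕ.* t) ℕ.* (qOf r / g ℕ.* g) ≡⟨ cong ((a / g ℕ.* t) ℕ.*_) (m/n*n≡m (gcd[m,n]∣m (qOf r) a)) ⟩
        (a / g ℕ.* t) ℕ.* qOf r ∎)
      where
      open ≡-Reasoning
      regroup : ∀ a' g t q' → a' ℕ.* g ℕ.* (t ℕ.* q') ≡ (a' ℕ.* t) ℕ.* (q' ℕ.* g)
      regroup = ℕSolver.solve-∀

    -- q/g is coprime to a/g, so it divides m once g·(q/g) ∣ g·(a/g)·m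
    q∣*⇒q/gcd∣ : ∀ {m} → qOf r ℕD.∣ a ℕ.* m → q/gcd r a ℕD.∣ m
    q∣*⇒q/gcd∣ {m} q∣am = coprime-divisor (coprime-/gcd (qOf r) a) (ℕD.*-cancelˡ-∣ g scaled)
      where
      regroup : ∀ a' g m → a' ℕ.* g ℕ.* m ≡ g ℕ.* (a' ℕ.* m)
      regroup = ℕSolver.solve-∀
      scaled : g ℕ.* (qOf r / g) ℕD.∣ g ℕ.* (a / g ℕ.* m)
      scaled = subst₂ ℕD._∣_ (trans (sym (m/n*n≡m (gcd[m,n]∣m (qOf r) a))) (ℕP.*-comm _ g))
                            (trans (cong (ℕ._* m) (sym (m/n*n≡m (gcd[m,n]∣n (qOf r) a)))) (regroup (a / g) g m))
                            q∣am

  -- Φ descends to the torus ℤ_{m_1}×…×ℤ_{m_r} modulo q exactly when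
  -- q ∣ i·m_i for every paper index i; this is the theorem's condition.
  Compatible : ∀ {r} → Vec ℕ r → Set
  Compatible {r} m = ∀ i → wt i * + lookup m i ≡ + 0 ⟨mod qOf r ⟩

  condition⇒Compatible : ∀ {r} (m : Vec ℕ r) →
    (∀ i → q/gcd r (toℕ i ℕ.+ 1) ℕD.∣ lookup m i) → Compatible m
  condition⇒Compatible {r} m h i = ∣⇒≡0 (∣ᵤ⇒∣ (subst (λ z → qOf r ℕD.∣ ℤ.∣ z ∣)
    (ℤP.pos-* (toℕ i ℕ.+ 1) (lookup m i)) (q/gcd∣⇒q∣* r (toℕ i ℕ.+ 1) (h i))))

  Compatible⇒condition : ∀ {r} (m : Vec ℕ r) →
    Compatible m → ∀ i → q/gcd r (toℕ i ℕ.+ 1) ℕD.∣ lookup m i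
  Compatible⇒condition {r} m H i = q∣*⇒q/gcd∣ r (toℕ i ℕ.+ 1) (subst (λ z → qOf r ℕD.∣ ℤ.∣ z ∣)
    (sym (ℤP.pos-* (toℕ i ℕ.+ 1) (lookup m i))) (∣⇒∣ᵤ (≡0⇒∣ (H i))))

  -- Under Compatible m, multiplying a congruence modulo m_k by the weight
  -- of k yields a congruence modulo q; hence Φ is well defined on the torus.

  scale-by-weight : ∀ {r} (m : Vec ℕ r) → Compatible m → ∀ k {a b} →
    a ≡ b ⟨mod lookup m k ⟩ → wt k * a ≡ wt k * b ⟨mod qOf r ⟩
  scale-by-weight {r} m H k {a} {b} (congruent (divides t a-b≡)) =
    congruent (subst (+ qOf r ∣_) (sym scaled) (∣n⇒∣m*n t (≡0⇒∣ (H k))))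
    where
    factor : ∀ w a b t m → a - b ≡ t * m → w * a - w * b ≡ t * (w * m)
    factor w a b t m e = trans (distrib w a b) (trans (cong (w *_) e) (swap w t m))
      where
      distrib : ∀ w a b → w * a - w * b ≡ w * (a - b)
      distrib = solve-∀
      swap : ∀ w t m → w * (t * m) ≡ t * (w * m)
      swap = solve-∀
    scaled : wt k * a - wt k * b ≡ t * (wt k * + lookup m k)
    scaled = factor (wt k) a b t (+ lookup m k) a-b≡

  CoordCong : ∀ {r} → Vec ℕ r → (Fin r → ℤ) → (Fin r → ℤ) → Set
  CoordCong m x y = ∀ i → x i ≡ y i ⟨mod lookup m i ⟩

  Φ-respects : ∀ {r} (m : Vec ℕ r) → Compatible m → ∀ x y → CoordCong m x y → Φ x ≡ Φ y ⟨mod qOf r ⟩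
  Φ-respects m H x y x≡y = Σ-mod (λ i → scale-by-weight m H i (x≡y i))

  pt : ∀ {r} → Vec ℕ r → Fin r → ℤ
  pt v i = + lookup v i

  Positive : ∀ {r} → Vec ℕ r → Set
  Positive m = ∀ i → 1 ℕ.≤ lookup m i

  vec-ext : ∀ {r} (u v : Vec ℕ r) → (∀ i → lookup u i ≡ lookup v i) → u ≡ v
  vec-ext u v h = trans (sym (tabulate∘lookup u)) (trans (tabulate-cong h) (tabulate∘lookup v))

  Move : ∀ {r} (m u v : Vec ℕ r) → Fin r → Sign → Set
  Move m u v k σ = (∀ j → j ≢ k → lookup u j ≡ lookup v j) × pt v k ≡ pt u k + unit σ ⟨mod lookup m k ⟩

  adjacent⇒move : ∀ {r} (m u v : Vec ℕ r) → TorusAdj m u v → ∃[ k ] ∃[ σ ] Move m u v k σ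
  adjacent⇒move m u v (_ , _ , k , agree , inj₁ c) = k , up   , agree , Cong⇒≡ c
  adjacent⇒move m u v (_ , _ , k , agree , inj₂ c) = k , down , agree , Cong⇒≡ c

  move⇒adjacent : ∀ {r} (m u v : Vec ℕ r) k σ → InTorus m u → InTorus m v → Move m u v k σ → TorusAdj m u v
  move⇒adjacent m u v k up   tu tv (agree , c) = tu , tv , k , agree , inj₁ (≡⇒Cong c)
  move⇒adjacent m u v k down tu tv (agree , c) = tu , tv , k , agree , inj₂ (≡⇒Cong c)

  Φ-move : ∀ {r} (m : Vec ℕ r) → Compatible m → ∀ u v k σ → Move m u v k σ →
    Φ (pt v) ≡ Φ (pt u) + signed σ (wt k) ⟨mod qOf r ⟩
  Φ-move {r} m H u v k σ (agree , c) = begin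
    Φ (pt v)                               ≡⟨ shift (Φ (pt v)) (Φ (pt u)) ⟩
    Φ (pt u) + (Φ (pt v) - Φ (pt u))       ≡⟨ cong (_+_ (Φ (pt u))) (Φ-single (pt v) (pt u) k (λ j j≢k → cong +_ (sym (agree j j≢k)))) ⟩
    Φ (pt u) + wt k * (pt v k - pt u k)    ≈⟨ mod-+ (mod-refl {a = Φ (pt u)}) (scale-by-weight m H k (moved c)) ⟩
    Φ (pt u) + wt k * unit σ               ≡⟨ cong (_+_ (Φ (pt u))) (sym (signed-as-* σ (wt k))) ⟩
    Φ (pt u) + signed σ (wt k)             ∎
    where
    open import Relation.Binary.Reasoning.Setoid (modSetoid (qOf r))
    shift : ∀ a b → a ≡ b + (a - b)
    shift = solve-∀
    moved : pt v k ≡ pt u k + unit σ ⟨mod lookup m k ⟩ → pt v k - pt u k ≡ unit σ ⟨mod lookup m k ⟩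
    moved e = subst (pt v k - pt u k ≡_⟨mod lookup m k ⟩) (cancel (pt u k) (unit σ)) (mod-- e (mod-refl {a = pt u k}))
      where
      cancel : ∀ a s → a + s - a ≡ s
      cancel = solve-∀

  module _ {r} (m : Vec ℕ r) (pos : Positive m) where

    private
      instance
        m-nonzero : ∀ {k} → NonZero (lookup m k)
        m-nonzero {k} = ℕ.>-nonZero (pos k)

    step : Vec ℕ r → Fin r → Sign → Vec ℕ r
    step w k σ = w [ k ]≔ ((pt w k + unit σ) %ℕ lookup m k)

    step-move : ∀ w k σ → Move m w (step w k σ) k σ
    step-move w k σ = (λ j j≢k → sym (lookup∘updateAt′ j k j≢k w)) ,
      subst (λ x → + x ≡ pt w k + unit σ ⟨mod lookup m k ⟩) (sym (lookup∘updateAt k w))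
        (mod-sym (%ℕ-≡ (pt w k + unit σ)))

    step-bound : ∀ w k σ → lookup (step w k σ) k ℕ.< lookup m k
    step-bound w k σ = subst (ℕ._< lookup m k) (sym (lookup∘updateAt k w)) (n%ℕd<d (pt w k + unit σ) (lookup m k))

    step-in-torus : ∀ w k σ → InTorus m w → InTorus m (step w k σ)
    step-in-torus w k σ tw j with j F.≟ k
    ... | yes refl = step-bound w j σ
    ... | no j≢k   = subst (ℕ._< lookup m j) (sym (lookup∘updateAt′ j k j≢k w)) (tw j)

    step-adjacent : ∀ w k σ → InTorus m w → TorusAdj m w (step w k σ)
    step-adjacent w k σ tw = move⇒adjacent m w (step w k σ) k σ tw (step-in-torus w k σ tw) (step-move w k σ)

    move-unique : ∀ w k σ u → InTorus m u → Move m w u k σ → u ≡ step w k σ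
    move-unique w k σ u tu (agree , c) = vec-ext u (step w k σ) coordinate
      where
      coordinate : ∀ j → lookup u j ≡ lookup (step w k σ) j
      coordinate j with j F.≟ k
      ... | yes refl = ≡-below-modulus (tu j) (step-bound w j σ) (mod-trans c (mod-sym (proj₂ (step-move w j σ))))
      ... | no j≢k   = trans (sym (agree j j≢k)) (proj₁ (step-move w k σ) j j≢k)

  -- The fibre of Φ over the residue b; these are the codes of the partition.
  record Fibre {r} (m : Vec ℕ r) (b : ℤ) (w : Vec ℕ r) : Set where
    constructor fibre
    field
      in-torus : InTorus m w
      weight≡  : Φ (pt w) ≡ b ⟨mod qOf r ⟩
  open Fibre public

  fibre-shift : ∀ {r} (m : Vec ℕ r) {b b' w} → b ≡ b' ⟨mod qOf r ⟩ → Fibre m b w → Fibre m b' w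
  fibre-shift m b≡b' (fibre tw Φw≡b) = fibre tw (mod-trans Φw≡b b≡b')

  -- Under Compatible m every fibre is a 1-perfect code: a vertex w outside
  -- the fibre has exactly one neighbour in it, namely the step whose signed
  -- weight is the nonzero residue b - Φ w.
  module _ {r} (m : Vec ℕ r) (pos : Positive m) (H : Compatible m) (b : ℤ) where

    fibre-independent : ∀ u v → Fibre m b u → Fibre m b v → ¬ TorusAdj m u v
    fibre-independent u v (fibre _ Φu≡b) (fibre _ Φv≡b) adj with adjacent⇒move m u v adj
    ... | k , σ , mv = signed-weight≢0 σ k (mod-trans (offset (Φ-move m H u v k σ mv) Φv≡b) b-Φu≡0)
      where
      b-Φu≡0 : b - Φ (pt u) ≡ + 0 ⟨mod qOf r ⟩
      b-Φu≡0 = subst (b - Φ (pt u) ≡_⟨mod qOf r ⟩) (ℤP.+-inverseʳ b) (mod-- (mod-refl {a = b}) Φu≡b)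

    neighbour-in-fibre : ∀ w k σ → InTorus m w → b - Φ (pt w) ≡ signed σ (wt k) ⟨mod qOf r ⟩ →
      Fibre m b (step m pos w k σ) × (∀ u' → Fibre m b u' → TorusAdj m w u' → u' ≡ step m pos w k σ)
    neighbour-in-fibre w k σ tw gap≡ = u-in , unique
      where
      restore : ∀ a c → a + (c - a) ≡ c
      restore = solve-∀
      u-in : Fibre m b (step m pos w k σ)
      u-in = fibre (step-in-torus m pos w k σ tw) $
        mod-trans (Φ-move m H w (step m pos w k σ) k σ (step-move m pos w k σ))
          (subst (Φ (pt w) + signed σ (wt k) ≡_⟨mod qOf r ⟩) (restore (Φ (pt w)) b)
            (mod-+ (mod-refl {a = Φ (pt w)}) (mod-sym gap≡)))
      unique : ∀ u' → Fibre m b u' → TorusAdj m w u' → u' ≡ step m pos w k σ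
      unique u' (fibre tu' Φu'≡b) adj = from-move (adjacent⇒move m w u' adj)
        where
        from-move : ∃[ k' ] ∃[ σ' ] Move m w u' k' σ' → u' ≡ step m pos w k σ
        from-move (k' , σ' , mv) = move-unique m pos w k σ u' tu' (subst₂ (Move m w u') k'≡k σ'≡σ mv)
          where
          same : σ' ≡ σ × k' ≡ k
          same = signed-weights-distinct σ' σ k' k (mod-trans (offset (Φ-move m H w u' k' σ' mv) Φu'≡b) gap≡)
          σ'≡σ : σ' ≡ σ
          σ'≡σ = proj₁ same
          k'≡k : k' ≡ k
          k'≡k = proj₂ same

    fibre-neighbour : ∀ w → InTorus m w → ¬ Fibre m b w →
      ∃[ u ] ((Fibre m b u × TorusAdj m w u) × (∀ u' → Fibre m b u' → TorusAdj m w u' → u' ≡ u))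
    fibre-neighbour w tw w∉ = step m pos w k σ ,
      (proj₁ (neighbour-in-fibre w k σ tw gap≡) , step-adjacent m pos w k σ tw) , proj₂ (neighbour-in-fibre w k σ tw gap≡)
      where
      gap≢0 : ¬ (b - Φ (pt w) ≡ + 0 ⟨mod qOf r ⟩)
      gap≢0 gap≡0 = w∉ (fibre tw (mod-sym (subst (b ≡_⟨mod qOf r ⟩) (ℤP.+-identityʳ (Φ (pt w)))
                                                  (Equivalence.to diff⇔sum gap≡0))))
      direction : ∃[ k ] ∃[ σ ] (b - Φ (pt w) ≡ signed σ (wt k) ⟨mod qOf r ⟩)
      direction = nonzero-residue-weight r (b - Φ (pt w)) gap≢0
      k : Fin r
      k = proj₁ direction
      σ : Sign
      σ = proj₁ (proj₂ direction)
      gap≡ : b - Φ (pt w) ≡ signed σ (wt k) ⟨mod qOf r ⟩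
      gap≡ = proj₂ (proj₂ direction)

    fibre-perfect : IsPerfectCode (InTorus m) (TorusAdj m) (Fibre m b)
    fibre-perfect = (λ _ → in-torus) , fibre-independent , fibre-neighbour

  module _ (n : ℕ) (m : Vec ℕ (suc (suc n))) (pos : Positive m) (H : Compatible m) where

    private
      r : ℕ
      r = suc (suc n)
      instance
        m-nonzero : ∀ {k} → NonZero (lookup m k)
        m-nonzero {k} = ℕ.>-nonZero (pos k)

    ρS₀⇒fibre : ∀ w → ρImage m (S₀ r) w → Fibre m (+ 0) w
    ρS₀⇒fibre w (x , x∈S₀ , tw , w≡x) =
      fibre tw (mod-trans (Φ-respects m H (pt w) x (λ i → Cong⇒≡ (w≡x i))) (S₀⇒Φ≡0 n x x∈S₀))

    fibre⇒ρS₀ : ∀ w → Fibre m (+ 0) w → ρImage m (S₀ r) w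
    fibre⇒ρS₀ w (fibre tw Φw≡0) = pt w , Φ≡0⇒S₀ n (pt w) Φw≡0 , tw , (λ i → ≡⇒Cong (mod-refl {a = pt w i}))

    translate⇒fibre : ∀ t w → Translate m t (ρImage m (S₀ r)) w → Fibre m (Φ (pt t)) w
    translate⇒fibre t w (tw , a , a∈ρS₀ , w≡t+a) = fibre tw (begin
      Φ (pt w)                          ≈⟨ Φ-respects m H (pt w) (λ i → pt t i + pt a i) (λ i → Cong⇒≡ (w≡t+a i)) ⟩
      Φ (λ i → pt t i + pt a i)         ≡⟨ Φ-+ (pt t) (pt a) ⟩
      Φ (pt t) + Φ (pt a)               ≈⟨ mod-+ (mod-refl {a = Φ (pt t)}) (weight≡ (ρS₀⇒fibre a a∈ρS₀)) ⟩
      Φ (pt t) + + 0                    ≡⟨ ℤP.+-identityʳ (Φ (pt t)) ⟩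
      Φ (pt t)                          ∎)
      where open import Relation.Binary.Reasoning.Setoid (modSetoid (qOf r))

    difference : Vec ℕ r → Vec ℕ r → Vec ℕ r
    difference t w = tabulate (λ i → (pt w i - pt t i) %ℕ lookup m i)

    difference-≡ : ∀ t w i → pt (difference t w) i ≡ pt w i - pt t i ⟨mod lookup m i ⟩
    difference-≡ t w i = subst (λ x → + x ≡ pt w i - pt t i ⟨mod lookup m i ⟩)
      (sym (lookup∘tabulate (λ i → (pt w i - pt t i) %ℕ lookup m i) i)) (mod-sym (%ℕ-≡ (pt w i - pt t i)))

    fibre⇒translate : ∀ t w → Fibre m (Φ (pt t)) w → Translate m t (ρImage m (S₀ r)) w
    fibre⇒translate t w (fibre tw Φw≡Φt) = tw , a , fibre⇒ρS₀ a (fibre a-in-torus Φa≡0) , w≡t+a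
      where
      open import Relation.Binary.Reasoning.Setoid (modSetoid (qOf r))
      a : Vec ℕ r
      a = difference t w
      a-in-torus : InTorus m a
      a-in-torus i = subst (ℕ._< lookup m i) (sym (lookup∘tabulate (λ i → (pt w i - pt t i) %ℕ lookup m i) i))
                           (n%ℕd<d (pt w i - pt t i) (lookup m i))
      Φa≡0 : Φ (pt a) ≡ + 0 ⟨mod qOf r ⟩
      Φa≡0 = begin
        Φ (pt a)                       ≈⟨ Φ-respects m H (pt a) (λ i → pt w i - pt t i) (difference-≡ t w) ⟩
        Φ (λ i → pt w i - pt t i)      ≡⟨ Φ-- (pt w) (pt t) ⟩
        Φ (pt w) - Φ (pt t)            ≈⟨ mod-- Φw≡Φt (mod-refl {a = Φ (pt t)}) ⟩
        Φ (pt t) - Φ (pt t)            ≡⟨ ℤP.+-inverseʳ (Φ (pt t)) ⟩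
        + 0                            ∎
      w≡t+a : ∀ i → Cong (lookup m i) (pt w i) (pt t i + pt a i)
      w≡t+a i = ≡⇒Cong (subst (_≡ pt t i + pt a i ⟨mod lookup m i ⟩) (restore (pt w i) (pt t i))
        (mod-+ (mod-refl {a = pt t i}) (mod-sym (difference-≡ t w i))))
        where
        restore : ∀ w t → t + (w - t) ≡ w
        restore = solve-∀

  axis : ∀ {r} → ℕ → Vec ℕ (suc r)
  axis {r} a = a ∷ replicate r 0

  axis-off : ∀ {r} a (j : Fin r) → lookup (axis a) (fsuc j) ≡ 0
  axis-off a j = lookup-replicate j 0

  Φ-axis : ∀ {r} a → Φ (pt (axis {r} a)) ≡ + a
  Φ-axis {r} a = trans (cong (_+_ (+ 1 * + a)) (Σ-zero (λ j → wt (fsuc j) * pt (axis {r} a) (fsuc j))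
                                     (λ j → trans (cong (λ y → wt (fsuc j) * + y) (axis-off a j)) (ℤP.*-zeroʳ (wt (fsuc j))))))
                   (trans (ℤP.+-identityʳ (+ 1 * + a)) (ℤP.*-identityˡ (+ a)))

  axis-in-torus : ∀ {r} (m : Vec ℕ (suc r)) → Positive m → ∀ {a} → a ℕ.< lookup m fzero → InTorus m (axis a)
  axis-in-torus m pos a<m₁ fzero    = a<m₁
  axis-in-torus m pos {a} a<m₁ (fsuc j) = subst (ℕ._< lookup m (fsuc j)) (sym (axis-off a j)) (pos (fsuc j))

  -- Necessity of the condition: if ρ(S₀) is an independent set then q ∣ i·m_i.
  -- Otherwise i·m_i ≡ ±wt k, and the point m_i e_i ∓ e_k of S₀ reduces to the
  -- neighbour of the origin one step ∓ in direction k, while the origin lies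
  -- in ρ(S₀) as well.
  module _ (n : ℕ) (m : Vec ℕ (suc (suc n))) (pos : Positive m) where

    private
      r : ℕ
      r = suc (suc n)

    origin : Vec ℕ r
    origin = axis 0

    origin-in-torus : InTorus m origin
    origin-in-torus = axis-in-torus m pos (pos fzero)

    pt-origin : ∀ j → pt origin j ≡ + 0
    pt-origin fzero    = refl
    pt-origin (fsuc j) = cong +_ (axis-off 0 j)

    origin∈ρS₀ : ρImage m (S₀ r) origin
    origin∈ρS₀ = (λ _ → + 0) , Φ≡0⇒S₀ n (λ _ → + 0) (mod-reflexive (Φ-zero {r} (λ _ → + 0) (λ _ → refl))) ,
                 origin-in-torus , λ j → ≡⇒Cong (mod-reflexive (pt-origin j))

    step-origin : ∀ k σ j → pt (step m pos origin k σ) j ≡ δ k (unit σ) j ⟨mod lookup m j ⟩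
    step-origin k σ j = by-cases (j F.≟ k) (step-move m pos origin k σ)
      where
      v : Vec ℕ r
      v = step m pos origin k σ
      by-cases : Dec (j ≡ k) → Move m origin v k σ → pt v j ≡ δ k (unit σ) j ⟨mod lookup m j ⟩
      by-cases (yes refl) (_ , moved) = subst (pt v j ≡_⟨mod lookup m j ⟩)
        (trans (cong (_+ unit σ) (pt-origin j)) (trans (ℤP.+-identityˡ (unit σ)) (sym (δ-at j (unit σ))))) moved
      by-cases (no j≢k) (agree , _) = mod-reflexive
        (trans (cong +_ (sym (agree j j≢k))) (trans (pt-origin j) (sym (δ-off k j (unit σ) j≢k))))

    independent⇒Compatible : (∀ u v → ρImage m (S₀ r) u → ρImage m (S₀ r) v → ¬ TorusAdj m u v) → Compatible m
    independent⇒Compatible indep i with + qOf r ∣? (wt i * + lookup m i)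
    ... | yes q∣ = ∣⇒≡0 q∣
    ... | no q∤ with nonzero-residue-weight r (wt i * + lookup m i) (λ e → q∤ (≡0⇒∣ e))
    ... | k , σ , im≡ = ⊥-elim (indep origin v origin∈ρS₀ v∈ρS₀ (step-adjacent m pos origin k (flip σ) origin-in-torus))
      where
      v : Vec ℕ r
      v = step m pos origin k (flip σ)
      x : Fin r → ℤ
      x j = δ k (unit (flip σ)) j + δ i (+ lookup m i) j
      Φx≡0 : Φ x ≡ + 0 ⟨mod qOf r ⟩
      Φx≡0 = begin
        Φ x                                                ≡⟨ Φ-+ (δ k (unit (flip σ))) (δ i (+ lookup m i)) ⟩
        Φ (δ k (unit (flip σ))) + Φ (δ i (+ lookup m i))   ≡⟨ cong₂ _+_ (trans (Φ-δ k _) (sym (signed-as-* (flip σ) (wt k)))) (Φ-δ i _) ⟩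
        signed (flip σ) (wt k) + wt i * + lookup m i       ≈⟨ mod-+ (mod-refl {a = signed (flip σ) (wt k)}) im≡ ⟩
        signed (flip σ) (wt k) + signed σ (wt k)           ≡⟨ cong (_+ signed σ (wt k)) (signed-flip σ (wt k)) ⟩
        - signed σ (wt k) + signed σ (wt k)                ≡⟨ ℤP.+-inverseˡ (signed σ (wt k)) ⟩
        + 0                                                ∎
        where open import Relation.Binary.Reasoning.Setoid (modSetoid (qOf r))
      side≡0 : ∀ j → δ i (+ lookup m i) j ≡ + 0 ⟨mod lookup m j ⟩
      side≡0 j with j F.≟ i
      ... | yes refl = ∣⇒≡0 ∣-refl
      ... | no _     = mod-refl
      v∈ρS₀ : ρImage m (S₀ r) v
      v∈ρS₀ = x , Φ≡0⇒S₀ n x Φx≡0 , step-in-torus m pos origin k (flip σ) origin-in-torus ,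
              λ j → ≡⇒Cong (subst (_≡ x j ⟨mod lookup m j ⟩) (ℤP.+-identityʳ (pt v j))
                              (mod-+ (step-origin k (flip σ) j) (mod-sym (side≡0 j))))

  partition⇒Compatible : ∀ n (m : Vec ℕ (suc (suc n))) → Positive m → ∀ S → IsCodePartition (suc (suc n)) m S → Compatible m
  partition⇒Compatible n m pos S P = independent⇒Compatible n m pos λ u v u∈ v∈ →
    proj₁ (proj₂ (proj₁ (proj₂ (proj₂ P)) fzero)) u v (Equivalence.from (proj₁ P u) u∈) (Equivalence.from (proj₁ P v) v∈)

  -- Two distinct residues modulo q differ by ±s with 1 ≤ s ≤ r, so the
  -- Cayley graph of ℤ_q with generators {1,…,r} is the complete graph.

  cayley⇒distinct : ∀ r (j j' : Fin (qOf r)) → CayleyAdj r j j' → j ≢ j'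
  cayley⇒distinct r j .j (s , (1≤s , s≤r) , j≡j±s) refl =
    small≢0 r s 1≤s (ℕP.≤-trans s≤r (ℕP.m≤n*m r 2)) (s≡0 j≡j±s)
    where
    a : ℤ
    a = + toℕ j
    s≡0 : Cong (qOf r) a (a + + s) ⊎ Cong (qOf r) a (a - + s) → + s ≡ + 0 ⟨mod qOf r ⟩
    s≡0 (inj₁ c) = mod-sym (subst (_≡ + s ⟨mod qOf r ⟩) (ℤP.+-inverseʳ a)
                                  (Equivalence.from (diff⇔sum {a = a} {b = a} {s = + s}) (Cong⇒≡ {a = a} {b = a + + s} c)))
    s≡0 (inj₂ c) = subst (_≡ + 0 ⟨mod qOf r ⟩) (ℤP.neg-involutive (+ s)) (mod-neg -s≡0)
      where
      -s≡0 : - + s ≡ + 0 ⟨mod qOf r ⟩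
      -s≡0 = mod-sym (subst (_≡ - + s ⟨mod qOf r ⟩) (ℤP.+-inverseʳ a)
                            (Equivalence.from (diff⇔sum {a = a} {b = a} {s = - + s}) (Cong⇒≡ {a = a} {b = a - + s} c)))

  distinct⇒cayley : ∀ r (j j' : Fin (qOf r)) → j ≢ j' → CayleyAdj r j j'
  distinct⇒cayley r j j' j≢j' with nonzero-residue-small r (+ toℕ j' - + toℕ j) gap≢0
    where
    gap≢0 : ¬ (+ toℕ j' - + toℕ j ≡ + 0 ⟨mod qOf r ⟩)
    gap≢0 e = j≢j' (sym (FP.toℕ-injective (≡-below-modulus (FP.toℕ<n j') (FP.toℕ<n j)
      (subst (+ toℕ j' ≡_⟨mod qOf r ⟩) (ℤP.+-identityʳ (+ toℕ j)) (Equivalence.to (diff⇔sum {a = + toℕ j} {b = + toℕ j'} {s = + 0}) e)))))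
  ... | s , bounds , inj₁ gap≡s  = s , bounds , inj₁ (≡⇒Cong (Equivalence.to (diff⇔sum {a = + toℕ j} {b = + toℕ j'} {s = + s}) gap≡s))
  ... | s , bounds , inj₂ gap≡-s = s , bounds , inj₂ (≡⇒Cong (Equivalence.to (diff⇔sum {a = + toℕ j} {b = + toℕ j'} {s = - + s}) gap≡-s))

  q∣m₁ : ∀ {r} (m : Vec ℕ (suc r)) → Compatible m → qOf (suc r) ℕD.∣ lookup m fzero
  q∣m₁ m H = subst (_ ℕD.∣_) (trans (ℤP.abs-* (+ 1) (+ lookup m fzero)) (ℕP.*-identityˡ (lookup m fzero)))
                   (∣⇒∣ᵤ (≡0⇒∣ (H fzero)))

  fibres-meet : ∀ {r} (m : Vec ℕ r) {b b' w} → Fibre m b w → Fibre m b' w → b ≡ b' ⟨mod qOf r ⟩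
  fibres-meet m (fibre _ Φw≡b) (fibre _ Φw≡b') = mod-trans (mod-sym Φw≡b) Φw≡b'

  module _ (n : ℕ) (m : Vec ℕ (suc (suc n))) (pos : Positive m) (H : Compatible m) where

    private
      r : ℕ
      r = suc (suc n)

    -- q ∣ 1·m₁, so the first axis is long enough to meet every fibre
    q≤m₁ : qOf r ℕ.≤ lookup m fzero
    q≤m₁ = ℕD.∣⇒≤ {{ℕ.>-nonZero (pos fzero)}} (q∣m₁ m H)

    fibre-point : ∀ b → Fibre m b (axis (b %ℕ qOf r))
    fibre-point b = fibre (axis-in-torus m pos (ℕP.<-≤-trans (n%ℕd<d b (qOf r)) q≤m₁))
                    (subst (_≡ b ⟨mod qOf r ⟩) (sym (Φ-axis {suc n} (b %ℕ qOf r))) (mod-sym (%ℕ-≡ b)))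

    -- the q fibres over 0, 1, …, 2r form a partition of the required kind,
    -- the fibre over j being the translate of ρ(S₀) by (j,0,…,0)
    fibreCodes : Fin (qOf r) → Vec ℕ r → Set
    fibreCodes j = Fibre m (+ toℕ j)

    fibre-partition : IsCodePartition r m fibreCodes
    fibre-partition = (λ w → mk⇔ (fibre⇒ρS₀ n m pos H w) (ρS₀⇒fibre n m pos H w)) , translate ,
      (λ j → fibre-perfect m pos H (+ toℕ j)) , (λ j w → in-torus) , cover , disjoint
      where
      translate : ∀ j → IsTranslateOf m (fibreCodes j) (ρImage m (S₀ r))
      translate j = t , axis-in-torus m pos (ℕP.<-≤-trans (FP.toℕ<n j) q≤m₁) ,
        λ w → mk⇔ (λ w∈ → fibre⇒translate n m pos H t w (fibre-shift m Φt≡j w∈))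
                  (λ w∈ → fibre-shift m (mod-sym Φt≡j) (translate⇒fibre n m pos H t w w∈))
        where
        t : Vec ℕ r
        t = axis (toℕ j)
        Φt≡j : + toℕ j ≡ Φ (pt t) ⟨mod qOf r ⟩
        Φt≡j = mod-reflexive (sym (Φ-axis {suc n} (toℕ j)))
      cover : ∀ w → InTorus m w → ∃[ j ] fibreCodes j w
      cover w tw = fromℕ< (n%ℕd<d (Φ (pt w)) (qOf r)) ,
        fibre tw (subst (λ x → Φ (pt w) ≡ + x ⟨mod qOf r ⟩) (sym (FP.toℕ-fromℕ< (n%ℕd<d (Φ (pt w)) (qOf r)))) (%ℕ-≡ (Φ (pt w))))
      disjoint : ∀ j j' w → j ≢ j' → fibreCodes j w → fibreCodes j' w → ⊥
      disjoint j j' w j≢j' w∈j w∈j' =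
        j≢j' (FP.toℕ-injective (≡-below-modulus (FP.toℕ<n j) (FP.toℕ<n j') (fibres-meet m w∈j w∈j')))

    -- In any such partition the j-th code is the fibre over Φ t_j, where
    -- t_j is its translation vector; distinct codes have distinct residues,
    -- hence every two of them are joined by an edge.
    module _ (S : Fin (qOf r) → Vec ℕ r → Set) (P : IsCodePartition r m S) where

      residue : Fin (qOf r) → ℤ
      residue j = Φ (pt (proj₁ (proj₁ (proj₂ P) j)))

      code⇔fibre : ∀ j w → S j w ⇔ Fibre m (residue j) w
      code⇔fibre j w = mk⇔ (λ w∈ → translate⇒fibre n m pos H t w (Equivalence.to (S⇔t+ρS₀ w) w∈))
                           (λ w∈ → Equivalence.from (S⇔t+ρS₀ w) (fibre⇒translate n m pos H t w w∈))
        where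
        t : Vec ℕ r
        t = proj₁ (proj₁ (proj₂ P) j)
        S⇔t+ρS₀ : ∀ w → S j w ⇔ Translate m t (ρImage m (S₀ r)) w
        S⇔t+ρS₀ = proj₂ (proj₂ (proj₁ (proj₂ P) j))

      representative : Fin (qOf r) → Vec ℕ r
      representative j = axis (residue j %ℕ qOf r)

      representative∈ : ∀ j → S j (representative j)
      representative∈ j = Equivalence.from (code⇔fibre j _) (fibre-point (residue j))

      residues-distinct : ∀ j j' → j ≢ j' → ¬ (residue j ≡ residue j' ⟨mod qOf r ⟩)
      residues-distinct j j' j≢j' e = proj₂ (proj₂ (proj₂ (proj₂ (proj₂ P)))) j j' (representative j) j≢j'
        (representative∈ j) (Equivalence.from (code⇔fibre j' _) (fibre-shift m e (fibre-point (residue j))))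

      codes-adjacent : ∀ j j' → j ≢ j' → QuotAdj r m S j j'
      codes-adjacent j j' j≢j' =
        j≢j' , representative j , u , representative∈ j , Equivalence.from (code⇔fibre j' u) u∈ , adj
        where
        rep∉ : ¬ Fibre m (residue j') (representative j)
        rep∉ rep∈ = residues-distinct j j' j≢j' (fibres-meet m (fibre-point (residue j)) rep∈)
        neighbour : ∃[ u ] ((Fibre m (residue j') u × TorusAdj m (representative j) u) ×
                            (∀ u' → Fibre m (residue j') u' → TorusAdj m (representative j) u' → u' ≡ u))
        neighbour = fibre-neighbour m pos H (residue j') (representative j) (in-torus (fibre-point (residue j))) rep∉
        u : Vec ℕ r
        u = proj₁ neighbour
        u∈ : Fibre m (residue j') u
        u∈ = proj₁ (proj₁ (proj₂ neighbour))
        adj : TorusAdj m (representative j) u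
        adj = proj₂ (proj₁ (proj₂ neighbour))

      quotient⇔cayley : ∀ j j' → QuotAdj r m S j j' ⇔ CayleyAdj r j j'
      quotient⇔cayley j j' = mk⇔ (λ adj → distinct⇒cayley r j j' (proj₁ adj))
                                 (λ c → codes-adjacent j j' (cayley⇒distinct r j j' c))

  module _ {A B : Set} where

    ∈-concatMap-intro : ∀ {xs} (f : A → List B) {x y} → x ∈ xs → y ∈ f x → y ∈ concatMap f xs
    ∈-concatMap-intro f x∈xs y∈fx = ∈-concatMap⁺ f (lose x∈xs y∈fx)

    ∈-concatMap-elim : ∀ xs (f : A → List B) {y} → y ∈ concatMap f xs → ∃[ x ] (x ∈ xs × y ∈ f x)
    ∈-concatMap-elim xs f y∈ = find (∈-concatMap⁻ f {xs = xs} y∈)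

    length-concatMap : ∀ xs (f : A → List B) c → (∀ x → length (f x) ≡ c) → length (concatMap f xs) ≡ length xs ℕ.* c
    length-concatMap []       f c h = refl
    length-concatMap (x ∷ xs) f c h = trans (LP.length-++ (f x)) (cong₂ ℕ._+_ (h x) (length-concatMap xs f c h))

    unique-concatMap : ∀ xs (f : A → List B) → Unique xs → (∀ x → Unique (f x)) →
      (∀ x x' y → y ∈ f x → y ∈ f x' → x ≡ x') → Unique (concatMap f xs)
    unique-concatMap []       f _ _ _ = []
    unique-concatMap (x ∷ xs) f u@(_ ∷ u') uf blocks-disjoint =
      UniqueP.++⁺ (uf x) (unique-concatMap xs f u' uf blocks-disjoint) disjoint
      where
      disjoint : ∀ {y} → ¬ (y ∈ f x × y ∈ concatMap f xs)
      disjoint (y∈fx , y∈rest) with ∈-concatMap-elim xs f y∈rest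
      ... | x' , x'∈xs , y∈fx' with blocks-disjoint x x' _ y∈fx y∈fx'
      ... | refl = UniqueP.Unique[x∷xs]⇒x∉xs u x'∈xs

  vertices : ∀ {r} → Vec ℕ r → List (Vec ℕ r)
  vertices []       = [] ∷ []
  vertices (a ∷ ms) = concatMap (λ rest → map (_∷ rest) (upTo a)) (vertices ms)

  same-tail : ∀ {r} (xs xs' : List ℕ) (rest rest' : Vec ℕ r) y →
    y ∈ map (_∷ rest) xs → y ∈ map (_∷ rest') xs' → rest ≡ rest'
  same-tail xs xs' rest rest' y y∈ y∈' with ∈-map⁻ (_∷ rest) y∈ | ∈-map⁻ (_∷ rest') y∈'
  ... | _ , _ , refl | _ , _ , e = proj₂ (∷-injective e)

  vertices-length : ∀ {r} (m : Vec ℕ r) → length (vertices m) ≡ prodℕ m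
  vertices-length []       = refl
  vertices-length (a ∷ ms) = trans
    (length-concatMap (vertices ms) _ a (λ rest → trans (LP.length-map (_∷ rest) (upTo a)) (LP.length-upTo a)))
    (trans (cong (ℕ._* a) (vertices-length ms)) (ℕP.*-comm (prodℕ ms) a))

  vertices-unique : ∀ {r} (m : Vec ℕ r) → Unique (vertices m)
  vertices-unique []       = All.[] ∷ []
  vertices-unique (a ∷ ms) = unique-concatMap (vertices ms) _ (vertices-unique ms)
    (λ rest → UniqueP.map⁺ (λ e → proj₁ (∷-injective e)) (UniqueP.upTo⁺ a))
    (λ rest rest' y → same-tail (upTo a) (upTo a) rest rest' y)

  ∈-vertices⁺ : ∀ {r} (m : Vec ℕ r) v → InTorus m v → v ∈ vertices m
  ∈-vertices⁺ []       []       _  = here refl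
  ∈-vertices⁺ (a ∷ ms) (x ∷ xs) tv =
    ∈-concatMap-intro _ (∈-vertices⁺ ms xs (λ i → tv (fsuc i))) (∈-map⁺ (_∷ xs) (∈-upTo⁺ (tv fzero)))

  ∈-vertices⁻ : ∀ {r} (m : Vec ℕ r) v → v ∈ vertices m → InTorus m v
  ∈-vertices⁻ (a ∷ ms) v v∈ with ∈-concatMap-elim (vertices ms) _ v∈
  ... | rest , rest∈ , v∈block with ∈-map⁻ (_∷ rest) v∈block
  ... | x , x∈ , refl = λ where
    fzero    → ∈-upTo⁻ x∈
    (fsuc i) → ∈-vertices⁻ ms rest rest∈ i

  module _ (d M : ℕ) .{{_ : NonZero d}} (d∣M : d ℕD.∣ M) where

    residueClass : ℤ → List ℕ
    residueClass c = map (λ t → c %ℕ d ℕ.+ t ℕ.* d) (upTo (M / d))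

    residueClass-length : ∀ c → length (residueClass c) ≡ M / d
    residueClass-length c = trans (LP.length-map _ (upTo (M / d))) (LP.length-upTo (M / d))

    residueClass-unique : ∀ c → Unique (residueClass c)
    residueClass-unique c = UniqueP.map⁺ (λ {t} {t'} e → ℕP.*-cancelʳ-≡ t t' d (ℕP.+-cancelˡ-≡ (c %ℕ d) _ _ e))
                                         (UniqueP.upTo⁺ (M / d))

    ∈-residueClass⁻ : ∀ c a → a ∈ residueClass c → a ℕ.< M × + a ≡ c ⟨mod d ⟩
    ∈-residueClass⁻ c a a∈ with ∈-map⁻ (λ t → c %ℕ d ℕ.+ t ℕ.* d) a∈
    ... | t , t∈ , refl = a<M , mod-trans a≡c%d (mod-sym (%ℕ-≡ c))
      where
      a<M : c %ℕ d ℕ.+ t ℕ.* d ℕ.< M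
      a<M = ℕP.<-≤-trans (ℕP.+-monoˡ-< (t ℕ.* d) (n%ℕd<d c d))
                         (subst (suc t ℕ.* d ℕ.≤_) (m/n*n≡m d∣M) (ℕP.*-monoˡ-≤ d (∈-upTo⁻ t∈)))
      a≡c%d : + (c %ℕ d ℕ.+ t ℕ.* d) ≡ + (c %ℕ d) ⟨mod d ⟩
      a≡c%d = congruent (divides (+ t) (trans (cong (_- + (c %ℕ d)) (trans (ℤP.pos-+ (c %ℕ d) _) (cong (_+_ (+ (c %ℕ d))) (ℤP.pos-* t d))))
                                              (cancel (+ (c %ℕ d)) (+ t * + d))))
        where
        cancel : ∀ a b → a + b - a ≡ b
        cancel = solve-∀

    ∈-residueClass⁺ : ∀ c a → a ℕ.< M → + a ≡ c ⟨mod d ⟩ → a ∈ residueClass c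
    ∈-residueClass⁺ c a a<M a≡c = subst (_∈ residueClass c) (sym a≡) (∈-map⁺ (λ t → c %ℕ d ℕ.+ t ℕ.* d) (∈-upTo⁺ a/d<M/d))
      where
      same-residue : a % d ≡ c %ℕ d
      same-residue = ≡-below-modulus (m%n<n a d) (n%ℕd<d c d) (mod-trans (mod-sym (%ℕ-≡ (+ a))) (mod-trans a≡c (%ℕ-≡ c)))
      a≡ : a ≡ c %ℕ d ℕ.+ (a / d) ℕ.* d
      a≡ = trans (m≡m%n+[m/n]*n a d) (cong (ℕ._+ (a / d) ℕ.* d) same-residue)
      a/d<M/d : a / d ℕ.< M / d
      a/d<M/d = m<n*o⇒m/o<n (subst (a ℕ.<_) (sym (m/n*n≡m d∣M)) a<M)

  -- Every fibre has m₁⋯m_r / q vertices when q ∣ m₁: for each choice of the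
  -- last r-1 coordinates, the first one runs through a residue class mod q.
  module _ {r} (m₀ : ℕ) (ms : Vec ℕ r) (q∣m₀ : qOf (suc r) ℕD.∣ m₀) where

    private
      q : ℕ
      q = qOf (suc r)

    Ψ : Vec ℕ r → ℤ
    Ψ rest = Σℤ (λ i → wt (fsuc i) * pt rest i)

    Φ-cons : ∀ a rest → Φ (pt (a ∷ rest)) ≡ + a + Ψ rest
    Φ-cons a rest = cong (_+ Ψ rest) (ℤP.*-identityˡ (+ a))

    fibreList : ℤ → List (Vec ℕ (suc r))
    fibreList b = concatMap (λ rest → map (_∷ rest) (residueClass q m₀ q∣m₀ (b - Ψ rest))) (vertices ms)

    weight⇔head : ∀ a rest b → (Φ (pt (a ∷ rest)) ≡ b ⟨mod q ⟩) ⇔ (+ a ≡ b - Ψ rest ⟨mod q ⟩)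
    weight⇔head a rest b = mk⇔
      (λ e → subst (_≡ b - Ψ rest ⟨mod q ⟩) (cancel (+ a) (Ψ rest))
                   (mod-- (subst (_≡ b ⟨mod q ⟩) (Φ-cons a rest) e) (mod-refl {a = Ψ rest})))
      (λ e → subst₂ (_≡_⟨mod q ⟩) (sym (Φ-cons a rest)) (restore b (Ψ rest)) (mod-+ e (mod-refl {a = Ψ rest})))
      where
      cancel : ∀ a p → a + p - p ≡ a
      cancel = solve-∀
      restore : ∀ b p → b - p + p ≡ b
      restore = solve-∀

    ∈-fibreList⁻ : ∀ b v → v ∈ fibreList b → Fibre (m₀ ∷ ms) b v
    ∈-fibreList⁻ b v v∈ with ∈-concatMap-elim (vertices ms) _ v∈
    ... | rest , rest∈ , v∈block with ∈-map⁻ (_∷ rest) v∈block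
    ... | a , a∈ , refl = fibre v-in-torus (Equivalence.from (weight⇔head a rest b) (proj₂ (∈-residueClass⁻ q m₀ q∣m₀ (b - Ψ rest) a a∈)))
      where
      v-in-torus : InTorus (m₀ ∷ ms) (a ∷ rest)
      v-in-torus fzero    = proj₁ (∈-residueClass⁻ q m₀ q∣m₀ (b - Ψ rest) a a∈)
      v-in-torus (fsuc i) = ∈-vertices⁻ ms rest rest∈ i

    ∈-fibreList⁺ : ∀ b v → Fibre (m₀ ∷ ms) b v → v ∈ fibreList b
    ∈-fibreList⁺ b (a ∷ rest) (fibre tv Φv≡b) =
      ∈-concatMap-intro _ (∈-vertices⁺ ms rest (λ i → tv (fsuc i)))
        (∈-map⁺ (_∷ rest) (∈-residueClass⁺ q m₀ q∣m₀ _ a (tv fzero) (Equivalence.to (weight⇔head a rest b) Φv≡b)))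

    fibre-card : ∀ b → HasCard (Fibre (m₀ ∷ ms) b) (prodℕ (m₀ ∷ ms) / q)
    fibre-card b = fibreList b , unique , (λ v → mk⇔ (∈-fibreList⁻ b v) (∈-fibreList⁺ b v)) , len
      where
      unique : Unique (fibreList b)
      unique = unique-concatMap (vertices ms) _ (vertices-unique ms)
        (λ rest → UniqueP.map⁺ (λ e → proj₁ (∷-injective e)) (residueClass-unique q m₀ q∣m₀ (b - Ψ rest)))
        (λ rest rest' y → same-tail _ _ rest rest' y)
      k : ℕ
      k = m₀ / q
      m₀≡ : k ℕ.* q ≡ m₀
      m₀≡ = m/n*n≡m q∣m₀
      swap : ∀ a b c → a ℕ.* b ℕ.* c ≡ a ℕ.* c ℕ.* b
      swap = ℕSolver.solve-∀
      len : length (fibreList b) ≡ prodℕ (m₀ ∷ ms) / q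
      len = begin
        length (fibreList b)            ≡⟨ length-concatMap (vertices ms) _ k (λ rest →
                                             trans (LP.length-map (_∷ rest) (residueClass q m₀ q∣m₀ (b - Ψ rest))) (residueClass-length q m₀ q∣m₀ (b - Ψ rest))) ⟩
        length (vertices ms) ℕ.* k      ≡⟨ cong (ℕ._* k) (vertices-length ms) ⟩
        prodℕ ms ℕ.* k                  ≡⟨ ℕP.*-comm (prodℕ ms) k ⟩
        k ℕ.* prodℕ ms                  ≡⟨ sym (m*n/n≡m (k ℕ.* prodℕ ms) q) ⟩
        k ℕ.* prodℕ ms ℕ.* q / q        ≡⟨ cong (_/ q) (swap k (prodℕ ms) q) ⟩
        k ℕ.* q ℕ.* prodℕ ms / q        ≡⟨ cong (λ x → x ℕ.* prodℕ ms / q) m₀≡ ⟩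
        m₀ ℕ.* prodℕ ms / q             ∎
        where open ≡-Reasoning

  normℕ : ∀ {n} → (Fin n → ℤ) → ℕ
  normℕ {zero}  f = 0
  normℕ {suc n} f = ℤ.∣ f fzero ∣ ℕ.* ℤ.∣ f fzero ∣ ℕ.+ normℕ (λ i → f (fsuc i))

  Σ-squares≡norm : ∀ {n} (f : Fin n → ℤ) → Σℤ (λ i → f i * f i) ≡ + normℕ f
  Σ-squares≡norm {zero}  f = refl
  Σ-squares≡norm {suc n} f = trans (cong₂ _+_ (square (f fzero)) (Σ-squares≡norm (λ i → f (fsuc i))))
                                   (sym (ℤP.pos-+ _ (normℕ (λ i → f (fsuc i)))))
    where
    square : ∀ x → x * x ≡ + (ℤ.∣ x ∣ ℕ.* ℤ.∣ x ∣)
    square (+ a)    = sym (ℤP.pos-* a a)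
    square -[1+ a ] = refl

  norm≡0 : ∀ {n} (f : Fin n → ℤ) → normℕ f ≡ 0 → ∀ i → f i ≡ + 0
  norm≡0 {suc n} f e i with ℤ.∣ f fzero ∣ in abs≡ | i
  ... | zero | fzero  = ℤP.∣i∣≡0⇒i≡0 abs≡
  ... | zero | fsuc i = norm≡0 (λ i → f (fsuc i)) e i

  norm≡1 : ∀ {n} (f : Fin n → ℤ) → normℕ f ≡ 1 → ∃[ k ] ((∀ j → j ≢ k → f j ≡ + 0) × (f k ≡ + 1 ⊎ f k ≡ - + 1))
  norm≡1 {suc n} f e with ℤ.∣ f fzero ∣ in abs≡
  ... | zero with norm≡1 (λ i → f (fsuc i)) e
  ...   | k , others , ±1 = fsuc k , zero-elsewhere , ±1
    where
    zero-elsewhere : ∀ j → j ≢ fsuc k → f j ≡ + 0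
    zero-elsewhere fzero    _    = ℤP.∣i∣≡0⇒i≡0 abs≡
    zero-elsewhere (fsuc j) j≢k = others j (λ e → j≢k (cong fsuc e))
  norm≡1 {suc n} f e | suc zero = fzero , zero-elsewhere , unit-abs (f fzero) abs≡
    where
    zero-elsewhere : ∀ j → j ≢ fzero → f j ≡ + 0
    zero-elsewhere fzero    j≢0 = ⊥-elim (j≢0 refl)
    zero-elsewhere (fsuc j) _   = norm≡0 (λ i → f (fsuc i)) (ℕP.suc-injective e) j
    unit-abs : ∀ x → ℤ.∣ x ∣ ≡ 1 → x ≡ + 1 ⊎ x ≡ - + 1
    unit-abs (+ .1)        refl = inj₁ refl
    unit-abs -[1+ zero ]   _    = inj₂ refl
  norm≡1 {suc n} f () | suc (suc a)

  grid-adjacent⇒step : ∀ {r} (m u v : Vec ℕ r) → GridAdj m v u →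
    ∃[ k ] ∃[ σ ] ((∀ j → j ≢ k → lookup v j ≡ lookup u j) × pt u k ≡ pt v k + unit σ)
  grid-adjacent⇒step {r} m u v (_ , _ , dist≡1) with norm≡1 diff (ℤP.+-injective (trans (sym (Σ-squares≡norm diff)) dist≡1))
    where
    diff : Fin r → ℤ
    diff i = pt v i - pt u i
  ... | k , others , ±1 = k , sign ±1 , (λ j j≢k → ℤP.+-injective (ℤP.i-j≡0⇒i≡j _ _ (others j j≢k))) , coordinate ±1
    where
    sign : pt v k - pt u k ≡ + 1 ⊎ pt v k - pt u k ≡ - + 1 → Sign
    sign (inj₁ _) = down
    sign (inj₂ _) = up
    solve-for : ∀ a b c → a - b ≡ c → b ≡ a + - c
    solve-for a b c e = trans (isolate a b) (cong (λ z → a + - z) e)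
      where
      isolate : ∀ a b → b ≡ a + - (a - b)
      isolate = solve-∀
    coordinate : (e : pt v k - pt u k ≡ + 1 ⊎ pt v k - pt u k ≡ - + 1) → pt u k ≡ pt v k + unit (sign e)
    coordinate (inj₁ e) = solve-for (pt v k) (pt u k) (+ 1) e
    coordinate (inj₂ e) = solve-for (pt v k) (pt u k) (- + 1) e

  -- Take w outside the fibre on a face w_k = 0 whose fibre neighbour lies
  -- one step σ across that face, and lift w to the grid point v on the
  -- side of the face that neighbour would need.  The T-neighbour u of v
  -- reduces into the fibre, so the residue computation forces u = v + σe_k,
  -- which leaves the grid.
  module _ (n : ℕ) (m : Vec ℕ (suc (suc n))) (pos : Positive m) (H : Compatible m)
           (2<m₁ : 2 ℕ.< lookup m fzero) where

    private
      r : ℕ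
      r = suc (suc n)
      instance
        m-nonzero : ∀ {k} → NonZero (lookup m k)
        m-nonzero {k} = ℕ.>-nonZero (pos k)

    record FaceWitness (b : ℤ) : Set where
      field
        w        : Vec ℕ r
        w-torus  : InTorus m w
        k        : Fin r
        σ        : Sign
        on-face  : lookup w k ≡ 0
        outside  : ¬ Fibre m b w
        gap      : b - Φ (pt w) ≡ signed σ (wt k) ⟨mod qOf r ⟩

    face-witness : ∀ b → FaceWitness b
    face-witness b with + qOf r ∣? b
    ... | no q∤b = record
      { w = origin n m pos ; w-torus = origin-in-torus n m pos ; k = proj₁ dir ; σ = proj₁ (proj₂ dir)
      ; on-face = cong ℤ.∣_∣ (pt-origin n m pos (proj₁ dir)) ; outside = λ o∈ → gap≢0 (≡⇒diff (fibres-meet m o∈ origin∈0))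
      ; gap = proj₂ (proj₂ dir) }
      where
      origin∈0 : Fibre m (+ 0) (origin n m pos)
      origin∈0 = fibre (origin-in-torus n m pos) (mod-reflexive (Φ-zero (pt (origin n m pos)) (pt-origin n m pos)))
      b-0≡b : b - Φ (pt (origin n m pos)) ≡ b
      b-0≡b = trans (cong (_-_ b) (Φ-zero (pt (origin n m pos)) (pt-origin n m pos))) (ℤP.+-identityʳ b)
      gap≢0 : ¬ (b - Φ (pt (origin n m pos)) ≡ + 0 ⟨mod qOf r ⟩)
      gap≢0 e = q∤b (≡0⇒∣ (subst (_≡ + 0 ⟨mod qOf r ⟩) b-0≡b e))
      ≡⇒diff : b ≡ + 0 ⟨mod qOf r ⟩ → b - Φ (pt (origin n m pos)) ≡ + 0 ⟨mod qOf r ⟩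
      ≡⇒diff e = subst (_≡ + 0 ⟨mod qOf r ⟩) (sym b-0≡b) e
      dir : ∃[ k ] ∃[ σ ] (b - Φ (pt (origin n m pos)) ≡ signed σ (wt k) ⟨mod qOf r ⟩)
      dir = nonzero-residue-weight r _ gap≢0
    ... | yes q∣b = record
      { w = axis 2 ; w-torus = axis-in-torus m pos 2<m₁ ; k = fsuc fzero ; σ = down
      ; on-face = refl ; outside = outside ; gap = gap }
      where
      b≡0 : b ≡ + 0 ⟨mod qOf r ⟩
      b≡0 = ∣⇒≡0 q∣b
      outside : ¬ Fibre m b (axis 2)
      outside (fibre _ Φ≡b) = small≢0 r 2 (s≤s z≤n) (s≤s (s≤s z≤n))
        (subst (_≡ + 0 ⟨mod qOf r ⟩) (Φ-axis {suc n} 2) (mod-trans Φ≡b b≡0))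
      gap : b - Φ (pt (axis {suc n} 2)) ≡ signed down (wt {r} (fsuc fzero)) ⟨mod qOf r ⟩
      gap = subst (λ x → b - x ≡ - + 2 ⟨mod qOf r ⟩) (sym (Φ-axis {suc n} 2))
              (mod-- b≡0 (mod-refl {a = + 2}))

    -- the height of the grid point over the face w_k = 0 on the σ-side
    faceValue : Sign → ℕ → ℕ
    faceValue up   M = M
    faceValue down M = 0

    faceValue≡0 : ∀ σ M → + faceValue σ M ≡ + 0 ⟨mod M ⟩
    faceValue≡0 up   M = ∣⇒≡0 ∣-refl
    faceValue≡0 down M = mod-refl

    faceValue≤ : ∀ σ M → faceValue σ M ℕ.≤ M
    faceValue≤ up   M = ℕP.≤-refl
    faceValue≤ down M = z≤n

    leaves-grid : ∀ σ M a → a ℕ.≤ M → + a ≡ + faceValue σ M + unit σ → ⊥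
    leaves-grid up   M a a≤M e = ℕP.<-irrefl refl (subst (ℕ._≤ M) a≡M+1 a≤M)
      where
      a≡M+1 : a ≡ suc M
      a≡M+1 = trans (ℤP.+-injective (trans e (sym (ℤP.pos-+ M 1)))) (ℕP.+-comm M 1)
    leaves-grid down M a a≤M ()

    no-grid-code : ∀ b (T : Vec ℕ r → Set) → IsPerfectCode (InGrid m) (GridAdj m) T →
      (∀ w → Fibre m b w ⇔ πImage m T w) → ⊥
    no-grid-code b T (_ , _ , T-neighbour) fibre⇔π =
      leaves-grid σ (lookup m k) (lookup u k) (proj₁ (proj₂ adj) k)
        (subst (λ x → pt u k ≡ + x + unit σ) (lookup∘updateAt k w) u-coordinate)
      where
      open FaceWitness (face-witness b)
      v : Vec ℕ r
      v = w [ k ]≔ faceValue σ (lookup m k)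
      v≡w : CoordCong m (pt v) (pt w)
      v≡w i with i F.≟ k
      ... | yes refl = subst₂ (λ x y → + x ≡ + y ⟨mod lookup m i ⟩) (sym (lookup∘updateAt i w)) (sym on-face)
                              (faceValue≡0 σ (lookup m i))
      ... | no i≢k   = mod-reflexive (cong +_ (lookup∘updateAt′ i k i≢k w))
      v-grid : InGrid m v
      v-grid i with i F.≟ k
      ... | yes refl = subst (ℕ._≤ lookup m i) (sym (lookup∘updateAt i w)) (faceValue≤ σ (lookup m i))
      ... | no i≢k   = subst (ℕ._≤ lookup m i) (sym (lookup∘updateAt′ i k i≢k w)) (ℕP.<⇒≤ (w-torus i))
      v∉T : ¬ T v
      v∉T Tv = outside (Equivalence.from (fibre⇔π w) (v , Tv , w-torus , λ i → ≡⇒Cong (mod-sym (v≡w i))))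
      neighbour : ∃[ u ] ((T u × GridAdj m v u) × (∀ u' → T u' → GridAdj m v u' → u' ≡ u))
      neighbour = T-neighbour v v-grid v∉T
      u : Vec ℕ r
      u = proj₁ neighbour
      adj : GridAdj m v u
      adj = proj₂ (proj₁ (proj₂ neighbour))
      πu : Vec ℕ r
      πu = tabulate (λ i → lookup u i % lookup m i)
      πu≡u : CoordCong m (pt πu) (pt u)
      πu≡u i = subst (λ x → + x ≡ pt u i ⟨mod lookup m i ⟩) (sym (lookup∘tabulate (λ i → lookup u i % lookup m i) i))
                     (mod-sym (%ℕ-≡ (pt u i)))
      πu-torus : InTorus m πu
      πu-torus i = subst (ℕ._< lookup m i) (sym (lookup∘tabulate (λ i → lookup u i % lookup m i) i)) (m%n<n (lookup u i) (lookup m i))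
      πu∈ : Fibre m b πu
      πu∈ = Equivalence.from (fibre⇔π πu) (u , proj₁ (proj₁ (proj₂ neighbour)) , πu-torus , λ i → ≡⇒Cong (πu≡u i))
      Φu≡b : Φ (pt u) ≡ b ⟨mod qOf r ⟩
      Φu≡b = mod-trans (Φ-respects m H (pt u) (pt πu) (λ i → mod-sym (πu≡u i))) (weight≡ πu∈)
      -- the T-neighbour is one unit step from v, in the same direction as the fibre neighbour of w
      unit-step : ∃[ k' ] ∃[ σ' ] ((∀ j → j ≢ k' → lookup v j ≡ lookup u j) × pt u k' ≡ pt v k' + unit σ')
      unit-step = grid-adjacent⇒step m u v adj
      k' : Fin r
      k' = proj₁ unit-step
      σ' : Sign
      σ' = proj₁ (proj₂ unit-step)
      same : σ' ≡ σ × k' ≡ k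
      same = signed-weights-distinct σ' σ k' k (begin
        signed σ' (wt k')       ≈⟨ offset (Φ-move m H v u k' σ' (proj₁ (proj₂ (proj₂ unit-step)) , mod-reflexive (proj₂ (proj₂ (proj₂ unit-step))))) Φu≡b ⟩
        b - Φ (pt v)            ≈⟨ mod-- (mod-refl {a = b}) (Φ-respects m H (pt v) (pt w) v≡w) ⟩
        b - Φ (pt w)            ≈⟨ gap ⟩
        signed σ (wt k)         ∎)
        where open import Relation.Binary.Reasoning.Setoid (modSetoid (qOf r))
      u-coordinate : pt u k ≡ pt v k + unit σ
      u-coordinate = subst₂ (λ k σ → pt u k ≡ pt v k + unit σ) (proj₂ same) (proj₁ same) (proj₂ (proj₂ (proj₂ unit-step)))

  HasCard-⇔ : ∀ {r} {S S' : Vec ℕ r → Set} {N} → (∀ v → S v ⇔ S' v) → HasCard S' N → HasCard S N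
  HasCard-⇔ S⇔S' (L , unique , ∈⇔S' , len) = L , unique , (λ v → ⇔-trans (∈⇔S' v) (⇔-sym (S⇔S' v))) , len

  code-card : ∀ {n} m₀ (ms : Vec ℕ (suc n)) → Positive (m₀ ∷ ms) → (H : Compatible (m₀ ∷ ms)) →
    ∀ S (P : IsCodePartition (suc (suc n)) (m₀ ∷ ms) S) j → HasCard (S j) (prodℕ (m₀ ∷ ms) / qOf (suc (suc n)))
  code-card {n} m₀ ms pos H S P j =
    HasCard-⇔ (code⇔fibre n (m₀ ∷ ms) pos H S P j) (fibre-card m₀ ms (q∣m₁ (m₀ ∷ ms) H) (residue n (m₀ ∷ ms) pos H S P j))

  code-not-grid-image : ∀ n (m : Vec ℕ (suc (suc n))) → Positive m → Compatible m → 2 ℕ.< lookup m fzero →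
    ∀ S (P : IsCodePartition (suc (suc n)) m S) j →
    ¬ (∃[ T ] (IsPerfectCode (InGrid m) (GridAdj m) T × (∀ w → S j w ⇔ πImage m T w)))
  code-not-grid-image n m pos H 2<m₁ S P j (T , T-code , S⇔πT) =
    no-grid-code n m pos H 2<m₁ (residue n m pos H S P j) T T-code
      (λ w → ⇔-trans (⇔-sym (code⇔fibre n m pos H S P j w)) (S⇔πT w))

open Development using
  (Positive; partition⇒Compatible; condition⇒Compatible; Compatible⇒condition;
   fibreCodes; fibre-partition; code-card; code-not-grid-image; codes-adjacent; quotient⇔cayley)

open import Defs
open import Data.Nat using (ℕ; _≤_; _+_; s≤s; z≤n)
import Data.Nat.Properties as ℕP
open import Data.Nat.Divisibility using (_∣_)
open import Data.Nat.DivMod using (_/_)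
open import Data.Fin using (Fin; toℕ; zero)
open import Data.Vec using (Vec; lookup; _∷_)
open import Data.Product using (Σ; _×_; _,_)
open import Relation.Binary.PropositionalEquality using (_≢_)
open import Relation.Nullary using (¬_)
open import Function.Bundles using (_⇔_; mk⇔)

corollary15 : (r : ℕ) → 2 ≤ r → (m : Vec ℕ r) → (∀ i → 3 ≤ lookup m i) →
    (((∀ (i : Fin r) → q/gcd r (toℕ i + 1) ∣ lookup m i)
        ⇔ Σ (Fin (qOf r) → Vec ℕ r → Set) (IsCodePartition r m))
    × ((S : Fin (qOf r) → Vec ℕ r → Set) → IsCodePartition r m S →
        ((∀ j → HasCard (S j) (prodℕ m / qOf r))
        × (∀ j → ¬ Σ (Vec ℕ r → Set) (λ T → IsPerfectCode (InGrid m) (GridAdj m) T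
                                          × (∀ w → S j w ⇔ πImage m T w)))
        × (∀ j j' → j ≢ j' → QuotAdj r m S j j')
        × (∀ j j' → QuotAdj r m S j j' ⇔ CayleyAdj r j j'))))
corollary15 .(2 + n) (s≤s (s≤s {n = n} _)) m@(m₀ ∷ ms) m≥3 =
  mk⇔ (λ condition → fibreCodes n m pos (condition⇒Compatible m condition) ,
                     fibre-partition n m pos (condition⇒Compatible m condition))
      (λ (S , P) → Compatible⇒condition m (partition⇒Compatible n m pos S P)) ,
  λ S P → let H = partition⇒Compatible n m pos S P in
    code-card m₀ ms pos H S P ,
    code-not-grid-image n m pos H (m≥3 zero) S P ,
    codes-adjacent n m pos H S P ,
    quotient⇔cayley n m pos H S P
  where
  pos : Positive m
  pos i = ℕP.≤-trans (s≤s z≤n) (m≥3 i)
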